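{- For a sequence $\sigma$ of nonnegative integers avoiding $010$ and $110$, let $\mathrm{forb}(\sigma)$ be the number of values $v\in\{0,\dots,\max(\sigma)\}$ such that $\sigma\cdot M v$ (obtained by appending a value $M>\max(\sigma)$ and then $v$) contains $010$ or $110$, with the convention $\mathrm{forb}(\text{empty word})=0$. For integers $n,m,f\geqslant 0$ let $\mathfrak{L}_{n,m,f}$ be the set of inversion sequences $\sigma$ of length $n\geqslant 1$ avoiding both $010$ and $110$ with maximum $m$ and $\mathrm{forb}(\sigma) = f$, and $\mathfrak{l}_{n,m,f} = \#\mathfrak{L}_{n,m,f}$. For $N,K,F\geqslant 0$ let $\mathfrak{j}_{N,K,F}$ be the number of words $\omega$ of length $N$ over $\{0,\dots,K-1\}$ avoiding $010$ and $110$ with $\mathrm{forb}(\omega)=F$, and $\mathfrak{k}_{N,K}$ the number of words of length $N$ over $\{0,\dots,K-1\}$ avoiding $010$ and $110$. Then for all $n\geqslant 1$, $m \geqslant 1$, $f\geqslant 0$, $$\mathfrak{l}_{n,m,f} = \sum_{p=m+1}^{n} \sum_{i=0}^{f-1} \sum_{j=0}^{m-1} \mathfrak{l}_{p-1,j,i} \cdot \Big(\mathfrak{j}_{n-p, m-i, f-i-1} + \delta_{f,m+1} \cdot \sum_{\ell=0}^{n-p-1} \mathfrak{k}_{\ell, m-i}\Big),$$ where $\delta$ is the Kronecker delta.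
   Context: An inversion sequence of length $n$ is a sequence $(\sigma_1,\dots,\sigma_n)$ of nonnegative integers with $\sigma_i<i$ for all $i$. A sequence $\sigma$ contains a pattern $p=(p_1,\dots,p_k)$ if some subsequence $(\sigma_{i_1},\dots,\sigma_{i_k})$ with $i_1<\dots<i_k$ is order-isomorphic to $p$; otherwise it avoids $p$. Avoiding $010$ means no indices $a<b<c$ with $\sigma_a=\sigma_c<\sigma_b$; avoiding $110$ means no indices $a<b<c$ with $\sigma_a=\sigma_b>\sigma_c$. Words over $\{0,\dots,K-1\}$ need not use every letter; the alphabet is empty when $K=0$, and the empty word is counted (so $\mathfrak{j}_{0,K,0}=\mathfrak{k}_{0,K}=1$). $\delta_{a,b}=1$ if $a=b$ and $0$ otherwise. -}

module Defs where

open import Data.Nat using (ℕ; zero; suc; _+_; _*_; _∸_; _<_; _⊔_; _≟_; _<?_; _≡ᵇ_)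
open import Data.Bool using (if_then_else_)
open import Data.List using (List; []; _∷_; _++_; map; concatMap; upTo; length; filter; foldr)
open import Data.Nat.ListAction using (sum)
open import Data.List.Relation.Unary.Any using (Any; any?)
open import Data.Product using (_×_; _,_)
open import Data.Sum using (_⊎_)
open import Data.Unit using (⊤; tt)
open import Relation.Nullary using (Dec; yes; ¬_)
open import Relation.Nullary.Decidable using (_×-dec_; _⊎-dec_; ¬?)
open import Relation.Binary.PropositionalEquality using (_≡_)

-- Triples of entries (σ_a, σ_b, σ_c) for all index triples a < b < c.
pairs : List ℕ → List (ℕ × ℕ)
pairs [] = []
pairs (y ∷ ys) = map (λ z → (y , z)) ys ++ pairs ys

triples : List ℕ → List (ℕ × ℕ × ℕ)
triples [] = []
triples (x ∷ xs) = map (λ { (y , z) → (x , y , z) }) (pairs xs) ++ triples xs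

Is010 : ℕ × ℕ × ℕ → Set
Is010 (x , y , z) = (x ≡ z) × (x < y)

Is110 : ℕ × ℕ × ℕ → Set
Is110 (x , y , z) = (x ≡ y) × (z < x)

is010? : (t : ℕ × ℕ × ℕ) → Dec (Is010 t)
is010? (x , y , z) = (x ≟ z) ×-dec (x <? y)

is110? : (t : ℕ × ℕ × ℕ) → Dec (Is110 t)
is110? (x , y , z) = (x ≟ y) ×-dec (z <? x)

Contains010 : List ℕ → Set
Contains010 σ = Any Is010 (triples σ)

Contains110 : List ℕ → Set
Contains110 σ = Any Is110 (triples σ)

Bad : List ℕ → Set
Bad σ = Contains010 σ ⊎ Contains110 σ

bad? : (σ : List ℕ) → Dec (Bad σ)
bad? σ = any? is010? (triples σ) ⊎-dec any? is110? (triples σ)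

Avoids : List ℕ → Set
Avoids σ = ¬ Bad σ

avoids? : (σ : List ℕ) → Dec (Avoids σ)
avoids? σ = ¬? (bad? σ)

maxL : List ℕ → ℕ
maxL = foldr _⊔_ 0

forb : List ℕ → ℕ
forb [] = 0
forb σ@(_ ∷ _) =
  length (filter (λ v → bad? (σ ++ (suc (maxL σ) ∷ v ∷ []))) (upTo (suc (maxL σ))))

words : ℕ → ℕ → List (List ℕ)
words K zero = [] ∷ []
words K (suc N) = concatMap (λ w → map (λ x → x ∷ w) (upTo K)) (words K N)

-- inversion sequence: i-th entry (1-indexed) is < i
IsInvFrom : ℕ → List ℕ → Set
IsInvFrom k [] = ⊤
IsInvFrom k (x ∷ xs) = (x < k) × IsInvFrom (suc k) xs

isInvFrom? : (k : ℕ) (σ : List ℕ) → Dec (IsInvFrom k σ)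
isInvFrom? k [] = yes tt
isInvFrom? k (x ∷ xs) = (x <? k) ×-dec isInvFrom? (suc k) xs

IsInv : List ℕ → Set
IsInv = IsInvFrom 1

-- every inversion sequence of length n is a word of length n over {0..n-1}
invSeqs : ℕ → List (List ℕ)
invSeqs n = filter (isInvFrom? 1) (words n n)

lcount : ℕ → ℕ → ℕ → ℕ
lcount n m f = length (filter (λ σ → avoids? σ ×-dec (maxL σ ≟ m) ×-dec (forb σ ≟ f)) (invSeqs n))

jcount : ℕ → ℕ → ℕ → ℕ
jcount N K F = length (filter (λ ω → avoids? ω ×-dec (forb ω ≟ F)) (words K N))

kcount : ℕ → ℕ → ℕ
kcount N K = length (filter avoids? (words K N))

δ : ℕ → ℕ → ℕ
δ a b = if a ≡ᵇ b then 1 else 0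

-- Σ_{i=a}^{b} g i  (empty if b < a)
sumFromTo : ℕ → ℕ → (ℕ → ℕ) → ℕ
sumFromTo a b g = sum (map (λ k → g (a + k)) (upTo (suc b ∸ a)))

sumBelow : ℕ → (ℕ → ℕ) → ℕ
sumBelow c g = sum (map g (upTo c))

-- Split σ ∈ 𝔏_{n,m,f} at the first occurrence of its maximum m, at some position p > m:
-- σ = α m γ, where α is an inversion sequence of length p - 1 with maximum j < m and
-- i = forb(α) forbidden letters. Then σ avoids 010 and 110 iff m γ does and γ uses none of
-- the letters forbidden by α, so γ ranges over the m - i remaining letters below m and m.
-- If m does not occur in γ, relabelling those letters monotonically by {0, …, m - i - 1}
-- turns γ into an avoiding word with forb(σ) = i + forb(γ) + 1, counted by 𝔧. If m occurs,
-- then γ = β m m … m with β such a word, and forb(σ) = m + 1: this is the δ-term, each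
-- length of β contributing a term 𝔨.

module Submission where

open import Defs
open import Data.Nat using (ℕ; zero; suc; _+_; _*_; _∸_; _≤_; _<_; _⊔_; _≟_; _<?_; _≤?_; z≤n; s≤s)
open import Data.Nat.Properties
open import Data.Nat.ListAction using (sum)
open import Data.List using (List; []; _∷_; _++_; map; concatMap; applyUpTo; upTo; length; filter)
open import Data.List.Properties using (length-upTo)
open import Data.List.Membership.Propositional using (_∈_; _∉_; find; lose)
open import Data.List.Membership.Propositional.Properties
  using (∈-map⁺; ∈-map⁻; ∈-++⁺ˡ; ∈-++⁺ʳ; ∈-++⁻; ∈-upTo⁻; ∈-filter⁻)
open import Data.List.Membership.DecPropositional _≟_ using (_∈?_; _∉?_)
open import Data.List.Relation.Unary.Any using (Any; here; there; any?)
open import Data.List.Relation.Unary.All as All using (All; []; _∷_; lookup; tabulate; all?)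
import Data.List.Relation.Unary.All.Properties as All
open import Data.List.Relation.Unary.AllPairs using (AllPairs; _∷_)
import Data.List.Relation.Unary.AllPairs.Properties as AllPairs
open import Data.Product using (Σ; ∃; ∃₂; _×_; _,_; proj₁; proj₂)
open import Data.Sum using (_⊎_; inj₁; inj₂)
open import Data.Empty using (⊥-elim)
open import Data.Unit using (tt)
open import Level using (Level)
open import Function using (_∘_; id)
open import Relation.Nullary using (Dec; yes; no; ¬_)
open import Relation.Nullary.Decidable using (_×-dec_; _⊎-dec_; ¬?; map′)
open import Relation.Unary using (Pred; Decidable)
open import Relation.Binary.Definitions using (tri<; tri≈; tri>)
open import Relation.Binary.PropositionalEquality using (_≡_; _≢_; refl; sym; trans; cong; cong₂; subst; module ≡-Reasoning)
open import Algebra.Properties.CommutativeSemigroup +-commutativeSemigroup using (interchange)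

private
  variable
    A B : Set
    ℓ ℓ′ : Level

∑ : List A → (A → ℕ) → ℕ
∑ xs g = sum (map g xs)

syntax ∑ xs (λ x → e) = ∑[ x ∈ xs ] e

∑-++ : (xs ys : List A) (g : A → ℕ) → ∑ (xs ++ ys) g ≡ ∑ xs g + ∑ ys g
∑-++ []       ys g = refl
∑-++ (x ∷ xs) ys g = trans (cong (g x +_) (∑-++ xs ys g)) (sym (+-assoc (g x) _ _))

∑-cong-∈ : (xs : List A) {f g : A → ℕ} → (∀ x → x ∈ xs → f x ≡ g x) → ∑ xs f ≡ ∑ xs g
∑-cong-∈ []       e = refl
∑-cong-∈ (x ∷ xs) e = cong₂ _+_ (e x (here refl)) (∑-cong-∈ xs (λ y p → e y (there p)))

∑-cong : (xs : List A) {f g : A → ℕ} → (∀ x → f x ≡ g x) → ∑ xs f ≡ ∑ xs g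
∑-cong xs e = ∑-cong-∈ xs (λ x _ → e x)

∑-zero : (xs : List A) (g : A → ℕ) → (∀ x → x ∈ xs → g x ≡ 0) → ∑ xs g ≡ 0
∑-zero []       g e = refl
∑-zero (x ∷ xs) g e = cong₂ _+_ (e x (here refl)) (∑-zero xs g (λ y p → e y (there p)))

∑-+ : (xs : List A) (f g : A → ℕ) → ∑[ x ∈ xs ] (f x + g x) ≡ ∑ xs f + ∑ xs g
∑-+ []       f g = refl
∑-+ (x ∷ xs) f g = trans (cong (f x + g x +_) (∑-+ xs f g)) (interchange (f x) (g x) _ _)

∑-*ˡ : (xs : List A) (c : ℕ) (f : A → ℕ) → ∑[ x ∈ xs ] (c * f x) ≡ c * ∑ xs f
∑-*ˡ []       c f = sym (*-zeroʳ c)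
∑-*ˡ (x ∷ xs) c f = trans (cong (c * f x +_) (∑-*ˡ xs c f)) (sym (*-distribˡ-+ c (f x) _))

∑-*ʳ : (xs : List A) (c : ℕ) (f : A → ℕ) → ∑[ x ∈ xs ] (f x * c) ≡ ∑ xs f * c
∑-*ʳ xs c f = trans (∑-cong xs (λ x → *-comm (f x) c)) (trans (∑-*ˡ xs c f) (*-comm c _))

∑-1≡length : (xs : List A) → ∑[ _ ∈ xs ] 1 ≡ length xs
∑-1≡length []       = refl
∑-1≡length (x ∷ xs) = cong suc (∑-1≡length xs)

∑-map : (f : A → B) (xs : List A) (g : B → ℕ) → ∑ (map f xs) g ≡ ∑[ x ∈ xs ] g (f x)
∑-map f []       g = refl
∑-map f (x ∷ xs) g = cong (g (f x) +_) (∑-map f xs g)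

∑-concatMap : (f : A → List B) (xs : List A) (g : B → ℕ) →
  ∑ (concatMap f xs) g ≡ ∑[ x ∈ xs ] ∑ (f x) g
∑-concatMap f []       g = refl
∑-concatMap f (x ∷ xs) g =
  trans (∑-++ (f x) (concatMap f xs) g) (cong (∑ (f x) g +_) (∑-concatMap f xs g))

∑-comm : (xs : List A) (ys : List B) (g : A → B → ℕ) →
  ∑[ x ∈ xs ] ∑[ y ∈ ys ] g x y ≡ ∑[ y ∈ ys ] ∑[ x ∈ xs ] g x y
∑-comm []       ys g = sym (∑-zero ys (λ _ → 0) (λ _ _ → refl))
∑-comm (x ∷ xs) ys g =
  trans (cong (∑ ys (g x) +_) (∑-comm xs ys g)) (sym (∑-+ ys (g x) (λ y → ∑[ x′ ∈ xs ] g x′ y)))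

∑-applyUpTo : (f : ℕ → ℕ) (n : ℕ) (g : ℕ → ℕ) → ∑ (applyUpTo f n) g ≡ ∑[ k ∈ upTo n ] g (f k)
∑-applyUpTo f zero    g = refl
∑-applyUpTo f (suc n) g = cong (g (f 0) +_)
  (trans (∑-applyUpTo (f ∘ suc) n g) (sym (∑-applyUpTo suc n (g ∘ f))))

∑-upTo-suc : (n : ℕ) (g : ℕ → ℕ) → ∑ (upTo (suc n)) g ≡ g 0 + ∑[ k ∈ upTo n ] g (suc k)
∑-upTo-suc n g = cong (g 0 +_) (∑-applyUpTo suc n g)

∑-upTo-+ : (a b : ℕ) (g : ℕ → ℕ) → ∑ (upTo (a + b)) g ≡ ∑ (upTo a) g + ∑[ k ∈ upTo b ] g (a + k)
∑-upTo-+ zero    b g = refl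
∑-upTo-+ (suc a) b g = begin
  ∑ (upTo (suc (a + b))) g                                         ≡⟨ ∑-upTo-suc (a + b) g ⟩
  g 0 + ∑[ k ∈ upTo (a + b) ] g (suc k)                            ≡⟨ cong (g 0 +_) (∑-upTo-+ a b (λ k → g (suc k))) ⟩
  g 0 + (∑[ k ∈ upTo a ] g (suc k) + ∑[ k ∈ upTo b ] g (suc a + k)) ≡⟨ sym (+-assoc (g 0) _ _) ⟩
  g 0 + ∑[ k ∈ upTo a ] g (suc k) + ∑[ k ∈ upTo b ] g (suc a + k)   ≡⟨ cong (_+ ∑[ k ∈ upTo b ] g (suc a + k)) (sym (∑-upTo-suc a g)) ⟩
  ∑ (upTo (suc a)) g + ∑[ k ∈ upTo b ] g (suc a + k)                ∎
  where open ≡-Reasoning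

∑-upTo-snoc : (n : ℕ) (g : ℕ → ℕ) → ∑ (upTo (suc n)) g ≡ ∑ (upTo n) g + g n
∑-upTo-snoc n g = begin
  ∑ (upTo (suc n)) g              ≡⟨ cong (λ k → ∑ (upTo k) g) (+-comm 1 n) ⟩
  ∑ (upTo (n + 1)) g              ≡⟨ ∑-upTo-+ n 1 g ⟩
  ∑ (upTo n) g + (g (n + 0) + 0)  ≡⟨ cong (∑ (upTo n) g +_) (trans (+-identityʳ _) (cong g (+-identityʳ n))) ⟩
  ∑ (upTo n) g + g n              ∎
  where open ≡-Reasoning

∑-upTo-cong : (n : ℕ) {f g : ℕ → ℕ} → (∀ k → k < n → f k ≡ g k) → ∑ (upTo n) f ≡ ∑ (upTo n) g
∑-upTo-cong n e = ∑-cong-∈ (upTo n) (λ k k∈ → e k (∈-upTo⁻ k∈))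

∑-upTo-vanishing : (k k′ : ℕ) (g : ℕ → ℕ) → k ≤ k′ → (∀ v → k ≤ v → g v ≡ 0) →
  ∑ (upTo k′) g ≡ ∑ (upTo k) g
∑-upTo-vanishing k k′ g k≤k′ g≡0 = begin
  ∑ (upTo k′) g
    ≡⟨ cong (λ t → ∑ (upTo t) g) (sym (m+[n∸m]≡n k≤k′)) ⟩
  ∑ (upTo (k + (k′ ∸ k))) g
    ≡⟨ ∑-upTo-+ k (k′ ∸ k) g ⟩
  ∑ (upTo k) g + ∑[ j ∈ upTo (k′ ∸ k) ] g (k + j)
    ≡⟨ cong (∑ (upTo k) g +_) (∑-zero (upTo (k′ ∸ k)) _ (λ j _ → g≡0 (k + j) (m≤m+n k j))) ⟩
  ∑ (upTo k) g + 0
    ≡⟨ +-identityʳ _ ⟩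
  ∑ (upTo k) g
    ∎
  where open ≡-Reasoning

𝟙 : {P : Set ℓ} → Dec P → ℕ
𝟙 (yes _) = 1
𝟙 (no _)  = 0

𝟙-cong : {P : Set ℓ} {Q : Set ℓ′} → (P → Q) → (Q → P) → (p? : Dec P) (q? : Dec Q) → 𝟙 p? ≡ 𝟙 q?
𝟙-cong to from (yes p) (yes q) = refl
𝟙-cong to from (yes p) (no ¬q) = ⊥-elim (¬q (to p))
𝟙-cong to from (no ¬p) (yes q) = ⊥-elim (¬p (from q))
𝟙-cong to from (no ¬p) (no ¬q) = refl

𝟙-× : {P : Set ℓ} {Q : Set ℓ′} (p? : Dec P) (q? : Dec Q) → 𝟙 (p? ×-dec q?) ≡ 𝟙 p? * 𝟙 q?
𝟙-× (yes p) (yes q) = refl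
𝟙-× (yes p) (no ¬q) = refl
𝟙-× (no ¬p) q?      = refl

𝟙-yes : {P : Set ℓ} (p? : Dec P) → P → 𝟙 p? ≡ 1
𝟙-yes (yes _) _ = refl
𝟙-yes (no ¬p) p = ⊥-elim (¬p p)

𝟙-no : {P : Set ℓ} (p? : Dec P) → ¬ P → 𝟙 p? ≡ 0
𝟙-no (yes p) ¬p = ⊥-elim (¬p p)
𝟙-no (no _)  _  = refl

𝟙-absorbˡ : {P : Set ℓ} {Q : Set ℓ′} → (P → Q) → (p? : Dec P) (q? : Dec Q) → 𝟙 p? * 𝟙 q? ≡ 𝟙 p?
𝟙-absorbˡ P⇒Q (yes p) q? = cong (_+ 0) (𝟙-yes q? (P⇒Q p))
𝟙-absorbˡ P⇒Q (no _)  q? = refl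

𝟙-all∷ : {P : Pred A ℓ} (P? : Decidable P) (x : A) (xs : List A) →
  𝟙 (all? P? (x ∷ xs)) ≡ 𝟙 (P? x) * 𝟙 (all? P? xs)
𝟙-all∷ P? x xs = trans
  (𝟙-cong (λ { (p ∷ ps) → p , ps }) (λ (p , ps) → p ∷ ps) (all? P? (x ∷ xs)) (P? x ×-dec all? P? xs))
  (𝟙-× (P? x) (all? P? xs))

δ≡𝟙 : ∀ a b → δ a b ≡ 𝟙 (a ≟ b)
δ≡𝟙 zero    zero    = refl
δ≡𝟙 zero    (suc b) = refl
δ≡𝟙 (suc a) zero    = refl
δ≡𝟙 (suc a) (suc b) = trans (δ≡𝟙 a b) (𝟙-cong (cong suc) suc-injective (a ≟ b) (suc a ≟ suc b))

module _ {P : Pred A ℓ} (P? : Decidable P) where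

  ∑-filter : (xs : List A) (g : A → ℕ) → ∑ (filter P? xs) g ≡ ∑[ x ∈ xs ] (𝟙 (P? x) * g x)
  ∑-filter []       g = refl
  ∑-filter (x ∷ xs) g with P? x
  ... | yes _ = cong₂ _+_ (sym (+-identityʳ (g x))) (∑-filter xs g)
  ... | no _  = ∑-filter xs g

  length-filter≡∑ : (xs : List A) → length (filter P? xs) ≡ ∑[ x ∈ xs ] 𝟙 (P? x)
  length-filter≡∑ xs = begin
    length (filter P? xs)          ≡⟨ sym (∑-1≡length (filter P? xs)) ⟩
    ∑[ _ ∈ filter P? xs ] 1        ≡⟨ ∑-filter xs (λ _ → 1) ⟩
    ∑[ x ∈ xs ] (𝟙 (P? x) * 1)     ≡⟨ ∑-cong xs (λ x → *-identityʳ _) ⟩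
    ∑[ x ∈ xs ] 𝟙 (P? x)           ∎
    where open ≡-Reasoning

  ∑-𝟙¬+∑-𝟙≡length : (xs : List A) → ∑[ x ∈ xs ] 𝟙 (¬? (P? x)) + ∑[ x ∈ xs ] 𝟙 (P? x) ≡ length xs
  ∑-𝟙¬+∑-𝟙≡length xs =
    trans (sym (∑-+ xs _ _)) (trans (∑-cong xs complement) (∑-1≡length xs))
    where
    complement : ∀ x → 𝟙 (¬? (P? x)) + 𝟙 (P? x) ≡ 1
    complement x with P? x
    ... | yes _ = refl
    ... | no _  = refl

∑-upTo-point : ∀ x n (g : ℕ → ℕ) → ∑[ j ∈ upTo n ] (𝟙 (x ≟ j) * g j) ≡ 𝟙 (x <? n) * g x
∑-upTo-point x zero    g = refl
∑-upTo-point x (suc n) g =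
  trans (∑-upTo-snoc n _) (trans (cong (_+ 𝟙 (x ≟ n) * g n) (∑-upTo-point x n g)) (last (x ≟ n)))
  where
  last : (x≟n : Dec (x ≡ n)) → 𝟙 (x <? n) * g x + 𝟙 x≟n * g n ≡ 𝟙 (x <? suc n) * g x
  last (yes refl) rewrite 𝟙-no (x <? x) (<-irrefl refl) | 𝟙-yes (x <? suc x) ≤-refl = refl
  last (no x≢n) = trans (+-identityʳ _)
    (cong (_* g x) (𝟙-cong m<n⇒m<1+n (λ x<1+n → ≤∧≢⇒< (≤-pred x<1+n) x≢n) (x <? n) (x <? suc n)))

∑-upTo-point′ : ∀ m K (g : ℕ → ℕ) → m < K → ∑[ x ∈ upTo K ] (𝟙 (x ≟ m) * g x) ≡ g m
∑-upTo-point′ m K g m<K = begin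
  ∑[ x ∈ upTo K ] (𝟙 (x ≟ m) * g x)  ≡⟨ ∑-cong (upTo K) (λ x → cong (_* g x) (𝟙-cong sym sym (x ≟ m) (m ≟ x))) ⟩
  ∑[ x ∈ upTo K ] (𝟙 (m ≟ x) * g x)  ≡⟨ ∑-upTo-point m K g ⟩
  𝟙 (m <? K) * g m                    ≡⟨ cong (_* g m) (𝟙-yes (m <? K) m<K) ⟩
  1 * g m                             ≡⟨ *-identityˡ (g m) ⟩
  g m                                 ∎
  where open ≡-Reasoning

∑-upTo-from : ∀ m n (G : ℕ → ℕ) → m < n → ∑[ a ∈ upTo n ] (𝟙 (m <? suc a) * G (suc a)) ≡ sumFromTo (suc m) n G
∑-upTo-from m n G m<n = begin
  ∑ (upTo n) H                                          ≡⟨ cong (λ k → ∑ (upTo k) H) (sym (m+[n∸m]≡n (<⇒≤ m<n))) ⟩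
  ∑ (upTo (m + (n ∸ m))) H                              ≡⟨ ∑-upTo-+ m (n ∸ m) H ⟩
  ∑ (upTo m) H + ∑[ k ∈ upTo (n ∸ m) ] H (m + k)        ≡⟨ cong₂ _+_ (∑-zero (upTo m) H belowM) (∑-cong (upTo (n ∸ m)) fromM) ⟩
  ∑[ k ∈ upTo (n ∸ m) ] G (suc m + k)                   ∎
  where
  open ≡-Reasoning
  H : ℕ → ℕ
  H a = 𝟙 (m <? suc a) * G (suc a)
  belowM : ∀ a → a ∈ upTo m → H a ≡ 0
  belowM a a∈ = cong (_* G (suc a)) (𝟙-no (m <? suc a) (λ m<1+a → <⇒≱ (∈-upTo⁻ a∈) (≤-pred m<1+a)))
  fromM : ∀ k → H (m + k) ≡ G (suc (m + k))
  fromM k rewrite 𝟙-yes (m <? suc (m + k)) (s≤s (m≤m+n m k)) = +-identityʳ _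

sumFromTo-empty : ∀ a b (G : ℕ → ℕ) → b < a → sumFromTo a b G ≡ 0
sumFromTo-empty a b G b<a = cong (λ k → sum (map (λ j → G (a + j)) (upTo k))) (m≤n⇒m∸n≡0 b<a)

∑-words-suc : (K N : ℕ) (g : List ℕ → ℕ) →
  ∑ (words K (suc N)) g ≡ ∑[ w ∈ words K N ] ∑[ x ∈ upTo K ] g (x ∷ w)
∑-words-suc K N g = trans (∑-concatMap (λ w → map (_∷ w) (upTo K)) (words K N) g)
  (∑-cong (words K N) (λ w → ∑-map (_∷ w) (upTo K) g))

∑-words-cong : (K N : ℕ) {f g : List ℕ → ℕ} →
  (∀ w → length w ≡ N → All (_< K) w → f w ≡ g w) → ∑ (words K N) f ≡ ∑ (words K N) g
∑-words-cong K zero    e = cong (_+ 0) (e [] refl [])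
∑-words-cong K (suc N) {f} {g} e = begin
  ∑ (words K (suc N)) f
    ≡⟨ ∑-words-suc K N f ⟩
  ∑[ w ∈ words K N ] ∑[ x ∈ upTo K ] f (x ∷ w)
    ≡⟨ ∑-words-cong K N (λ w |w| w<K → ∑-upTo-cong K (λ x x<K → e (x ∷ w) (cong suc |w|) (x<K ∷ w<K))) ⟩
  ∑[ w ∈ words K N ] ∑[ x ∈ upTo K ] g (x ∷ w)
    ≡⟨ sym (∑-words-suc K N g) ⟩
  ∑ (words K (suc N)) g
    ∎
  where open ≡-Reasoning

∑-words-shrink : (K K′ N : ℕ) (g : List ℕ → ℕ) → K′ ≤ K →
  (∀ w → length w ≡ N → ¬ All (_< K′) w → g w ≡ 0) → ∑ (words K N) g ≡ ∑ (words K′ N) g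
∑-words-shrink K K′ zero    g K′≤K g≡0 = refl
∑-words-shrink K K′ (suc N) g K′≤K g≡0 = begin
  ∑ (words K (suc N)) g                           ≡⟨ ∑-words-suc K N g ⟩
  ∑[ w ∈ words K N ] ∑[ x ∈ upTo K ] g (x ∷ w)    ≡⟨ ∑-words-cong K N (λ w |w| _ → ∑-upTo-vanishing K′ K _ K′≤K (head≥K′ w |w|)) ⟩
  ∑[ w ∈ words K N ] ∑[ x ∈ upTo K′ ] g (x ∷ w)   ≡⟨ ∑-words-shrink K K′ N _ K′≤K tail≮K′ ⟩
  ∑[ w ∈ words K′ N ] ∑[ x ∈ upTo K′ ] g (x ∷ w)  ≡⟨ sym (∑-words-suc K′ N g) ⟩
  ∑ (words K′ (suc N)) g                          ∎
  where
  open ≡-Reasoning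
  head≥K′ : ∀ w → length w ≡ N → ∀ x → K′ ≤ x → g (x ∷ w) ≡ 0
  head≥K′ w |w| x K′≤x = g≡0 (x ∷ w) (cong suc |w|) (λ { (x<K′ ∷ _) → <⇒≱ x<K′ K′≤x })
  tail≮K′ : ∀ w → length w ≡ N → ¬ All (_< K′) w → ∑[ x ∈ upTo K′ ] g (x ∷ w) ≡ 0
  tail≮K′ w |w| w≮K′ = ∑-zero (upTo K′) _ (λ x _ → g≡0 (x ∷ w) (cong suc |w|) (λ { (_ ∷ w<K′) → w≮K′ w<K′ }))

∑-words-constant : (m K : ℕ) → m < K → (N : ℕ) → ∑[ w ∈ words K N ] 𝟙 (all? (_≟ m) w) ≡ 1
∑-words-constant m K m<K zero    = refl
∑-words-constant m K m<K (suc N) = begin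
  ∑[ w ∈ words K (suc N) ] 𝟙 (all? (_≟ m) w)
    ≡⟨ ∑-words-suc K N _ ⟩
  ∑[ w ∈ words K N ] ∑[ x ∈ upTo K ] 𝟙 (all? (_≟ m) (x ∷ w))
    ≡⟨ ∑-cong (words K N) (λ w → ∑-cong (upTo K) (λ x → 𝟙-all∷ (_≟ m) x w)) ⟩
  ∑[ w ∈ words K N ] ∑[ x ∈ upTo K ] (𝟙 (x ≟ m) * 𝟙 (all? (_≟ m) w))
    ≡⟨ ∑-cong (words K N) (λ w → ∑-upTo-point′ m K _ m<K) ⟩
  ∑[ w ∈ words K N ] 𝟙 (all? (_≟ m) w)
    ≡⟨ ∑-words-constant m K m<K N ⟩
  1
    ∎
  where open ≡-Reasoning

-- `enum` says that ψ 0, …, ψ (c - 1) enumerate the letters below K satisfying P.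
module _ {P : Pred ℕ ℓ} (P? : Decidable P) (K c : ℕ) (ψ : ℕ → ℕ)
         (enum : ∀ (g : ℕ → ℕ) → ∑[ x ∈ upTo K ] (𝟙 (P? x) * g x) ≡ ∑[ y ∈ upTo c ] g (ψ y)) where

  ∑-words-relabel : (N : ℕ) (H : List ℕ → ℕ) →
    ∑[ γ ∈ words K N ] (𝟙 (all? P? γ) * H γ) ≡ ∑[ β ∈ words c N ] H (map ψ β)
  ∑-words-relabel zero    H = cong (_+ 0) (+-identityʳ (H []))
  ∑-words-relabel (suc N) H = begin
    ∑[ γ ∈ words K (suc N) ] (𝟙 (all? P? γ) * H γ)
      ≡⟨ ∑-words-suc K N _ ⟩
    ∑[ w ∈ words K N ] ∑[ x ∈ upTo K ] (𝟙 (all? P? (x ∷ w)) * H (x ∷ w))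
      ≡⟨ ∑-cong (words K N) (λ w → ∑-cong (upTo K) (λ x → split x w)) ⟩
    ∑[ w ∈ words K N ] ∑[ x ∈ upTo K ] (𝟙 (all? P? w) * (𝟙 (P? x) * H (x ∷ w)))
      ≡⟨ ∑-cong (words K N) (λ w → ∑-*ˡ (upTo K) (𝟙 (all? P? w)) _) ⟩
    ∑[ w ∈ words K N ] (𝟙 (all? P? w) * ∑[ x ∈ upTo K ] (𝟙 (P? x) * H (x ∷ w)))
      ≡⟨ ∑-cong (words K N) (λ w → cong (𝟙 (all? P? w) *_) (enum (λ x → H (x ∷ w)))) ⟩
    ∑[ w ∈ words K N ] (𝟙 (all? P? w) * ∑[ y ∈ upTo c ] H (ψ y ∷ w))
      ≡⟨ ∑-words-relabel N (λ w → ∑[ y ∈ upTo c ] H (ψ y ∷ w)) ⟩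
    ∑[ β ∈ words c N ] ∑[ y ∈ upTo c ] H (ψ y ∷ map ψ β)
      ≡⟨ sym (∑-words-suc c N _) ⟩
    ∑[ β ∈ words c (suc N) ] H (map ψ β)
      ∎
    where
    open ≡-Reasoning
    split : ∀ x w → 𝟙 (all? P? (x ∷ w)) * H (x ∷ w) ≡ 𝟙 (all? P? w) * (𝟙 (P? x) * H (x ∷ w))
    split x w = begin
      𝟙 (all? P? (x ∷ w)) * H (x ∷ w)            ≡⟨ cong (_* H (x ∷ w)) (𝟙-all∷ P? x w) ⟩
      𝟙 (P? x) * 𝟙 (all? P? w) * H (x ∷ w)       ≡⟨ cong (_* H (x ∷ w)) (*-comm (𝟙 (P? x)) _) ⟩
      𝟙 (all? P? w) * 𝟙 (P? x) * H (x ∷ w)       ≡⟨ *-assoc (𝟙 (all? P? w)) _ _ ⟩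
      𝟙 (all? P? w) * (𝟙 (P? x) * H (x ∷ w))     ∎

module FirstOccurrence (m K : ℕ) (m<K : m < K) where

  firstAt : (L : ℕ) (g : List ℕ → ℕ) (a : ℕ) → ℕ
  firstAt L g a = ∑[ α ∈ words K a ] (𝟙 (m ∉? α) * ∑[ γ ∈ words K L ] g (α ++ m ∷ γ))

  prependOther : (List ℕ → ℕ) → List ℕ → ℕ
  prependOther g w = ∑[ x ∈ upTo K ] (𝟙 (¬? (x ≟ m)) * g (x ∷ w))

  𝟙∈-∷ : ∀ x w t → 𝟙 (m ∈? (x ∷ w)) * t ≡ 𝟙 (x ≟ m) * t + 𝟙 (m ∈? w) * (𝟙 (¬? (x ≟ m)) * t)
  𝟙∈-∷ x w t with x ≟ m
  ... | yes refl rewrite 𝟙-yes (x ∈? (x ∷ w)) (here refl) =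
    sym (trans (cong (1 * t +_) (*-zeroʳ (𝟙 (x ∈? w)))) (+-identityʳ _))
  ... | no x≢m = trans
    (cong (_* t) (𝟙-cong (λ { (here m≡x) → ⊥-elim (x≢m (sym m≡x)) ; (there m∈w) → m∈w }) there (m ∈? (x ∷ w)) (m ∈? w)))
    (cong (𝟙 (m ∈? w) *_) (sym (+-identityʳ t)))

  𝟙∉-∷ : ∀ x w t → 𝟙 (m ∉? (x ∷ w)) * t ≡ 𝟙 (m ∉? w) * (𝟙 (¬? (x ≟ m)) * t)
  𝟙∉-∷ x w t with x ≟ m
  ... | yes refl rewrite 𝟙-no (x ∉? (x ∷ w)) (λ x∉ → x∉ (here refl)) = sym (*-zeroʳ (𝟙 (x ∉? w)))
  ... | no x≢m = trans
    (cong (_* t) (𝟙-cong (λ m∉ m∈ → m∉ (there m∈)) (λ m∉ → λ { (here m≡x) → x≢m (sym m≡x) ; (there m∈) → m∉ m∈ })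
                         (m ∉? (x ∷ w)) (m ∉? w)))
    (cong (𝟙 (m ∉? w) *_) (sym (+-identityʳ t)))

  firstAt-suc : ∀ L g a → firstAt L g (suc a) ≡ firstAt L (prependOther g) a
  firstAt-suc L g a = begin
    ∑[ α ∈ words K (suc a) ] (𝟙 (m ∉? α) * T α)
      ≡⟨ ∑-words-suc K a _ ⟩
    ∑[ α ∈ words K a ] ∑[ x ∈ upTo K ] (𝟙 (m ∉? (x ∷ α)) * T (x ∷ α))
      ≡⟨ ∑-cong (words K a) (λ α → ∑-cong (upTo K) (λ x → 𝟙∉-∷ x α _)) ⟩
    ∑[ α ∈ words K a ] ∑[ x ∈ upTo K ] (𝟙 (m ∉? α) * (𝟙 (¬? (x ≟ m)) * T (x ∷ α)))
      ≡⟨ ∑-cong (words K a) (λ α → ∑-*ˡ (upTo K) (𝟙 (m ∉? α)) _) ⟩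
    ∑[ α ∈ words K a ] (𝟙 (m ∉? α) * ∑[ x ∈ upTo K ] (𝟙 (¬? (x ≟ m)) * T (x ∷ α)))
      ≡⟨ ∑-cong (words K a) (λ α → cong (𝟙 (m ∉? α) *_) (pull α)) ⟩
    firstAt L (prependOther g) a
      ∎
    where
    open ≡-Reasoning
    T : List ℕ → ℕ
    T α = ∑[ γ ∈ words K L ] g (α ++ m ∷ γ)
    pull : ∀ α → ∑[ x ∈ upTo K ] (𝟙 (¬? (x ≟ m)) * T (x ∷ α)) ≡ ∑[ γ ∈ words K L ] prependOther g (α ++ m ∷ γ)
    pull α = trans
      (∑-cong (upTo K) (λ x → sym (∑-*ˡ (words K L) (𝟙 (¬? (x ≟ m))) (λ γ → g (x ∷ α ++ m ∷ γ)))))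
      (∑-comm (upTo K) (words K L) (λ x γ → 𝟙 (¬? (x ≟ m)) * g (x ∷ α ++ m ∷ γ)))

  ∑-words-∈ : (N : ℕ) (g : List ℕ → ℕ) →
    ∑[ σ ∈ words K N ] (𝟙 (m ∈? σ) * g σ) ≡ ∑[ a ∈ upTo N ] firstAt (N ∸ suc a) g a
  ∑-words-∈ zero    g = cong (_+ 0) (𝟙-no (m ∈? []) (λ ()))
  ∑-words-∈ (suc N) g = begin
    ∑[ σ ∈ words K (suc N) ] (𝟙 (m ∈? σ) * g σ)
      ≡⟨ ∑-words-suc K N _ ⟩
    ∑[ w ∈ words K N ] ∑[ x ∈ upTo K ] (𝟙 (m ∈? (x ∷ w)) * g (x ∷ w))
      ≡⟨ ∑-cong (words K N) (λ w → ∑-cong (upTo K) (λ x → 𝟙∈-∷ x w _)) ⟩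
    ∑[ w ∈ words K N ] ∑[ x ∈ upTo K ] (𝟙 (x ≟ m) * g (x ∷ w) + 𝟙 (m ∈? w) * (𝟙 (¬? (x ≟ m)) * g (x ∷ w)))
      ≡⟨ ∑-cong (words K N) (λ w → trans (∑-+ (upTo K) _ _) (cong₂ _+_ (∑-upTo-point′ m K (λ x → g (x ∷ w)) m<K) (∑-*ˡ (upTo K) (𝟙 (m ∈? w)) _))) ⟩
    ∑[ w ∈ words K N ] (g (m ∷ w) + 𝟙 (m ∈? w) * prependOther g w)
      ≡⟨ ∑-+ (words K N) _ _ ⟩
    ∑[ w ∈ words K N ] g (m ∷ w) + ∑[ w ∈ words K N ] (𝟙 (m ∈? w) * prependOther g w)
      ≡⟨ cong₂ _+_ (sym (trans (+-identityʳ _) (+-identityʳ _))) (∑-words-∈ N (prependOther g)) ⟩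
    firstAt N g 0 + ∑[ a ∈ upTo N ] firstAt (N ∸ suc a) (prependOther g) a
      ≡⟨ cong (firstAt N g 0 +_) (∑-cong (upTo N) (λ a → sym (firstAt-suc (N ∸ suc a) g a))) ⟩
    firstAt N g 0 + ∑[ a ∈ upTo N ] firstAt (N ∸ suc a) g (suc a)
      ≡⟨ sym (∑-upTo-suc N (λ a → firstAt (suc N ∸ suc a) g a)) ⟩
    ∑[ a ∈ upTo (suc N) ] firstAt (suc N ∸ suc a) g a
      ∎
    where open ≡-Reasoning

∈-pairs-∷⁻ : ∀ {a v x y} → (x , y) ∈ pairs (a ∷ v) → (x ≡ a × y ∈ v) ⊎ (x , y) ∈ pairs v
∈-pairs-∷⁻ {a} {v} mem with ∈-++⁻ (map (λ z → (a , z)) v) mem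
... | inj₂ q = inj₂ q
... | inj₁ q with ∈-map⁻ (λ z → (a , z)) q
... | z , z∈ , refl = inj₁ (refl , z∈)

∈-pairs-∷⁺ˡ : ∀ {a v y} → y ∈ v → (a , y) ∈ pairs (a ∷ v)
∈-pairs-∷⁺ˡ {a} {v} mem = ∈-++⁺ˡ (∈-map⁺ (λ z → (a , z)) mem)

∈-pairs-∷⁺ʳ : ∀ {a v p} → p ∈ pairs v → p ∈ pairs (a ∷ v)
∈-pairs-∷⁺ʳ {a} {v} mem = ∈-++⁺ʳ (map (λ z → (a , z)) v) mem

∈-pairs⁻ : ∀ {u x y} → (x , y) ∈ pairs u → x ∈ u × y ∈ u
∈-pairs⁻ {[]} ()
∈-pairs⁻ {a ∷ u} mem with ∈-pairs-∷⁻ {a} {u} mem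
... | inj₁ (refl , y∈) = here refl , there y∈
... | inj₂ q with ∈-pairs⁻ {u} q
... | p1 , p2 = there p1 , there p2

∈-pairs-++⁻ : ∀ u {v x y} → (x , y) ∈ pairs (u ++ v) → (x , y) ∈ pairs u ⊎ (x , y) ∈ pairs v ⊎ (x ∈ u × y ∈ v)
∈-pairs-++⁻ [] mem = inj₂ (inj₁ mem)
∈-pairs-++⁻ (a ∷ u) {v} mem with ∈-pairs-∷⁻ {a} {u ++ v} mem
... | inj₁ (refl , y∈) with ∈-++⁻ u y∈
...   | inj₁ yu = inj₁ (∈-pairs-∷⁺ˡ yu)
...   | inj₂ yv = inj₂ (inj₂ (here refl , yv))
∈-pairs-++⁻ (a ∷ u) {v} mem | inj₂ q with ∈-pairs-++⁻ u q
...   | inj₁ r = inj₁ (∈-pairs-∷⁺ʳ {a} {u} r)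
...   | inj₂ (inj₁ r) = inj₂ (inj₁ r)
...   | inj₂ (inj₂ (xu , yv)) = inj₂ (inj₂ (there xu , yv))

∈-pairs-++⁺ˡ : ∀ u {v p} → p ∈ pairs u → p ∈ pairs (u ++ v)
∈-pairs-++⁺ˡ [] ()
∈-pairs-++⁺ˡ (a ∷ u) {v} {x , y} mem with ∈-pairs-∷⁻ {a} {u} mem
... | inj₁ (refl , y∈) = ∈-pairs-∷⁺ˡ (∈-++⁺ˡ y∈)
... | inj₂ q = ∈-pairs-∷⁺ʳ {a} {u ++ v} (∈-pairs-++⁺ˡ u q)

∈-pairs-++⁺ʳ : ∀ u {v p} → p ∈ pairs v → p ∈ pairs (u ++ v)
∈-pairs-++⁺ʳ [] mem = mem
∈-pairs-++⁺ʳ (a ∷ u) {v} mem = ∈-pairs-∷⁺ʳ {a} {u ++ v} (∈-pairs-++⁺ʳ u mem)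

∈-pairs-++⁺ : ∀ u {v x y} → x ∈ u → y ∈ v → (x , y) ∈ pairs (u ++ v)
∈-pairs-++⁺ (a ∷ u) (here refl) yv = ∈-pairs-∷⁺ˡ (∈-++⁺ʳ u yv)
∈-pairs-++⁺ (a ∷ u) {v} (there xu) yv = ∈-pairs-∷⁺ʳ {a} {u ++ v} (∈-pairs-++⁺ u xu yv)

∈-triples-∷⁻ : ∀ {a v x y z} → (x , y , z) ∈ triples (a ∷ v) → (x ≡ a × (y , z) ∈ pairs v) ⊎ (x , y , z) ∈ triples v
∈-triples-∷⁻ {a} {v} mem with ∈-++⁻ (map (λ p → (a , proj₁ p , proj₂ p)) (pairs v)) mem
... | inj₂ q = inj₂ q
... | inj₁ q with ∈-map⁻ (λ p → (a , proj₁ p , proj₂ p)) q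
... | (y , z) , p∈ , refl = inj₁ (refl , p∈)

∈-triples-∷⁺ˡ : ∀ {a v y z} → (y , z) ∈ pairs v → (a , y , z) ∈ triples (a ∷ v)
∈-triples-∷⁺ˡ {a} {v} mem = ∈-++⁺ˡ (∈-map⁺ (λ p → (a , proj₁ p , proj₂ p)) mem)

∈-triples-∷⁺ʳ : ∀ {a v t} → t ∈ triples v → t ∈ triples (a ∷ v)
∈-triples-∷⁺ʳ {a} {v} mem = ∈-++⁺ʳ (map (λ p → (a , proj₁ p , proj₂ p)) (pairs v)) mem

∈-triples⁻ : ∀ {u x y z} → (x , y , z) ∈ triples u → x ∈ u × y ∈ u × z ∈ u
∈-triples⁻ {[]} ()
∈-triples⁻ {a ∷ u} mem with ∈-triples-∷⁻ {a} {u} mem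
... | inj₁ (refl , p) with ∈-pairs⁻ {u} p
...   | p1 , p2 = here refl , there p1 , there p2
∈-triples⁻ {a ∷ u} mem | inj₂ q with ∈-triples⁻ {u} q
...   | p1 , p2 , p3 = there p1 , there p2 , there p3

∈-triples-++⁻ : ∀ u {v x y z} → (x , y , z) ∈ triples (u ++ v) →
  (x , y , z) ∈ triples u ⊎ (x , y , z) ∈ triples v ⊎ (x ∈ u × (y , z) ∈ pairs v) ⊎ ((x , y) ∈ pairs u × z ∈ v)
∈-triples-++⁻ [] mem = inj₂ (inj₁ mem)
∈-triples-++⁻ (a ∷ u) {v} mem with ∈-triples-∷⁻ {a} {u ++ v} mem
... | inj₁ (refl , p) with ∈-pairs-++⁻ u p
...   | inj₁ r = inj₁ (∈-triples-∷⁺ˡ {a} {u} r)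
...   | inj₂ (inj₁ r) = inj₂ (inj₂ (inj₁ (here refl , r)))
...   | inj₂ (inj₂ (yu , zv)) = inj₂ (inj₂ (inj₂ (∈-pairs-∷⁺ˡ yu , zv)))
∈-triples-++⁻ (a ∷ u) {v} mem | inj₂ q with ∈-triples-++⁻ u q
...   | inj₁ r = inj₁ (∈-triples-∷⁺ʳ {a} {u} r)
...   | inj₂ (inj₁ r) = inj₂ (inj₁ r)
...   | inj₂ (inj₂ (inj₁ (xu , r))) = inj₂ (inj₂ (inj₁ (there xu , r)))
...   | inj₂ (inj₂ (inj₂ (r , zv))) = inj₂ (inj₂ (inj₂ (∈-pairs-∷⁺ʳ {a} {u} r , zv)))

∈-triples-++⁺ˡ : ∀ u {v t} → t ∈ triples u → t ∈ triples (u ++ v)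
∈-triples-++⁺ˡ [] ()
∈-triples-++⁺ˡ (a ∷ u) {v} {x , y , z} mem with ∈-triples-∷⁻ {a} {u} mem
... | inj₁ (refl , p) = ∈-triples-∷⁺ˡ {a} {u ++ v} (∈-pairs-++⁺ˡ u p)
... | inj₂ q = ∈-triples-∷⁺ʳ {a} {u ++ v} (∈-triples-++⁺ˡ u q)

∈-triples-++⁺ʳ : ∀ u {v t} → t ∈ triples v → t ∈ triples (u ++ v)
∈-triples-++⁺ʳ [] mem = mem
∈-triples-++⁺ʳ (a ∷ u) {v} mem = ∈-triples-∷⁺ʳ {a} {u ++ v} (∈-triples-++⁺ʳ u mem)

∈-triples-++⁺₁ : ∀ u {v x y z} → x ∈ u → (y , z) ∈ pairs v → (x , y , z) ∈ triples (u ++ v)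
∈-triples-++⁺₁ (a ∷ u) {v} (here refl) p = ∈-triples-∷⁺ˡ {a} {u ++ v} (∈-pairs-++⁺ʳ u p)
∈-triples-++⁺₁ (a ∷ u) {v} (there xu) p = ∈-triples-∷⁺ʳ {a} {u ++ v} (∈-triples-++⁺₁ u xu p)

∈-triples-++⁺₂ : ∀ u {v x y z} → (x , y) ∈ pairs u → z ∈ v → (x , y , z) ∈ triples (u ++ v)
∈-triples-++⁺₂ (a ∷ u) {v} {x} {y} mem zv with ∈-pairs-∷⁻ {a} {u} mem
... | inj₁ (refl , yu) = ∈-triples-∷⁺ˡ {a} {u ++ v} (∈-pairs-++⁺ u yu zv)
... | inj₂ q = ∈-triples-∷⁺ʳ {a} {u ++ v} (∈-triples-++⁺₂ u q zv)

module _ (ψ : ℕ → ℕ) where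
  ∈-pairs-map⁻ : ∀ β {x y} → (x , y) ∈ pairs (map ψ β) → ∃₂ λ x′ y′ → (x′ , y′) ∈ pairs β × x ≡ ψ x′ × y ≡ ψ y′
  ∈-pairs-map⁻ [] ()
  ∈-pairs-map⁻ (a ∷ β) mem with ∈-pairs-∷⁻ {ψ a} {map ψ β} mem
  ... | inj₁ (refl , y∈) with ∈-map⁻ ψ y∈
  ...   | y′ , y′∈ , refl = a , y′ , ∈-pairs-∷⁺ˡ y′∈ , refl , refl
  ∈-pairs-map⁻ (a ∷ β) mem | inj₂ q with ∈-pairs-map⁻ β q
  ...   | x′ , y′ , p , e1 , e2 = x′ , y′ , ∈-pairs-∷⁺ʳ {a} {β} p , e1 , e2

  ∈-pairs-map⁺ : ∀ β {x y} → (x , y) ∈ pairs β → (ψ x , ψ y) ∈ pairs (map ψ β)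
  ∈-pairs-map⁺ [] ()
  ∈-pairs-map⁺ (a ∷ β) mem with ∈-pairs-∷⁻ {a} {β} mem
  ... | inj₁ (refl , y∈) = ∈-pairs-∷⁺ˡ (∈-map⁺ ψ y∈)
  ... | inj₂ q = ∈-pairs-∷⁺ʳ {ψ a} {map ψ β} (∈-pairs-map⁺ β q)

  ∈-triples-map⁻ : ∀ β {x y z} → (x , y , z) ∈ triples (map ψ β) →
    Σ ℕ λ x′ → Σ ℕ λ y′ → Σ ℕ λ z′ → (x′ , y′ , z′) ∈ triples β × x ≡ ψ x′ × y ≡ ψ y′ × z ≡ ψ z′
  ∈-triples-map⁻ [] ()
  ∈-triples-map⁻ (a ∷ β) mem with ∈-triples-∷⁻ {ψ a} {map ψ β} mem
  ... | inj₁ (refl , p) with ∈-pairs-map⁻ β p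
  ...   | y′ , z′ , p′ , refl , refl = a , y′ , z′ , ∈-triples-∷⁺ˡ {a} {β} p′ , refl , refl , refl
  ∈-triples-map⁻ (a ∷ β) mem | inj₂ q with ∈-triples-map⁻ β q
  ...   | x′ , y′ , z′ , p , e1 , e2 , e3 = x′ , y′ , z′ , ∈-triples-∷⁺ʳ {a} {β} p , e1 , e2 , e3

  ∈-triples-map⁺ : ∀ β {x y z} → (x , y , z) ∈ triples β → (ψ x , ψ y , ψ z) ∈ triples (map ψ β)
  ∈-triples-map⁺ [] ()
  ∈-triples-map⁺ (a ∷ β) mem with ∈-triples-∷⁻ {a} {β} mem
  ... | inj₁ (refl , p) = ∈-triples-∷⁺ˡ {ψ a} {map ψ β} (∈-pairs-map⁺ β p)
  ... | inj₂ q = ∈-triples-∷⁺ʳ {ψ a} {map ψ β} (∈-triples-map⁺ β q)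


Pattern : ℕ × ℕ × ℕ → Set
Pattern t = Is010 t ⊎ Is110 t

Bad-intro : ∀ σ {t} → t ∈ triples σ → Pattern t → Bad σ
Bad-intro σ t∈ (inj₁ p) = inj₁ (lose t∈ p)
Bad-intro σ t∈ (inj₂ p) = inj₂ (lose t∈ p)

Bad-elim : ∀ σ → Bad σ → ∃ λ t → t ∈ triples σ × Pattern t
Bad-elim σ (inj₁ b) = let t , t∈ , p = find b in t , t∈ , inj₁ p
Bad-elim σ (inj₂ b) = let t , t∈ , p = find b in t , t∈ , inj₂ p

Avoids-++ˡ : ∀ u v → Avoids (u ++ v) → Avoids u
Avoids-++ˡ u v av b = let _ , t∈ , p = Bad-elim u b in av (Bad-intro (u ++ v) (∈-triples-++⁺ˡ u t∈) p)

Avoids-++ʳ : ∀ u v → Avoids (u ++ v) → Avoids v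
Avoids-++ʳ u v av b = let _ , t∈ , p = Bad-elim v b in av (Bad-intro (u ++ v) (∈-triples-++⁺ʳ u t∈) p)

Avoids-∷ : ∀ x v → Avoids (x ∷ v) → Avoids v
Avoids-∷ x = Avoids-++ʳ (x ∷ [])

∈⇒≤maxL : ∀ {x σ} → x ∈ σ → x ≤ maxL σ
∈⇒≤maxL {σ = a ∷ σ} (here refl) = m≤m⊔n a (maxL σ)
∈⇒≤maxL {σ = a ∷ σ} (there x∈) = ≤-trans (∈⇒≤maxL x∈) (m≤n⊔m a (maxL σ))

maxL-lub : ∀ {M} σ → All (_≤ M) σ → maxL σ ≤ M
maxL-lub []      []       = z≤n
maxL-lub (a ∷ σ) (a≤ ∷ σ≤) = ⊔-lub a≤ (maxL-lub σ σ≤)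

maxL≡0⊎∈ : ∀ σ → maxL σ ≡ 0 ⊎ maxL σ ∈ σ
maxL≡0⊎∈ []      = inj₁ refl
maxL≡0⊎∈ (a ∷ σ) with ⊔-sel a (maxL σ)
... | inj₁ max≡a = inj₂ (subst (_∈ a ∷ σ) (sym max≡a) (here refl))
... | inj₂ max≡maxσ with maxL≡0⊎∈ σ
...   | inj₁ maxσ≡0 = inj₁ (trans max≡maxσ maxσ≡0)
...   | inj₂ maxσ∈  = inj₂ (subst (_∈ a ∷ σ) (sym max≡maxσ) (there maxσ∈))

maxL-++ : ∀ u v → maxL (u ++ v) ≡ maxL u ⊔ maxL v
maxL-++ []      v = refl
maxL-++ (a ∷ u) v = trans (cong (a ⊔_) (maxL-++ u v)) (sym (⊔-assoc a (maxL u) (maxL v)))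

-- Appending M v (M above every entry) creates a 010 exactly when v occurs in σ,
-- and a 110 exactly when v lies below a value repeated in σ.
BelowRepeat : List ℕ → ℕ → Set
BelowRepeat σ v = ∃ λ a → (a , a) ∈ pairs σ × v < a

Forbidden : List ℕ → ℕ → Set
Forbidden σ v = v ∈ σ ⊎ BelowRepeat σ v

belowRepeat? : ∀ σ v → Dec (BelowRepeat σ v)
belowRepeat? σ v =
  map′ to from (any? (λ (a , b) → (a ≟ b) ×-dec (v <? a)) (pairs σ))
  where
  to : Any (λ (a , b) → a ≡ b × v < a) (pairs σ) → BelowRepeat σ v
  to r with find r
  ... | (a , _) , p∈ , refl , v<a = a , p∈ , v<a
  from : BelowRepeat σ v → Any (λ (a , b) → a ≡ b × v < a) (pairs σ)
  from (a , p∈ , v<a) = lose p∈ (refl , v<a)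

forbidden? : ∀ σ v → Dec (Forbidden σ v)
forbidden? σ v = (v ∈? σ) ⊎-dec belowRepeat? σ v

Forbidden⇒≤maxL : ∀ σ v → Forbidden σ v → v ≤ maxL σ
Forbidden⇒≤maxL σ v (inj₁ v∈) = ∈⇒≤maxL v∈
Forbidden⇒≤maxL σ v (inj₂ (a , p∈ , v<a)) = ≤-trans (<⇒≤ v<a) (∈⇒≤maxL (proj₁ (∈-pairs⁻ {σ} p∈)))

Forbidden-< : ∀ {m} σ v → All (_< m) σ → Forbidden σ v → v < m
Forbidden-< σ v σ<m (inj₁ v∈) = lookup σ<m v∈
Forbidden-< σ v σ<m (inj₂ (a , p∈ , v<a)) = <-trans v<a (lookup σ<m (proj₁ (∈-pairs⁻ {σ} p∈)))

module _ (σ : List ℕ) (M v : ℕ) (σ<M : All (_< M) σ) where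

  Bad-append⇒Forbidden : Avoids σ → Bad (σ ++ M ∷ v ∷ []) → Forbidden σ v
  Bad-append⇒Forbidden av b with Bad-elim (σ ++ M ∷ v ∷ []) b
  ... | (x , y , z) , t∈ , p with ∈-triples-++⁻ σ t∈
  ... | inj₁ t∈σ = ⊥-elim (av (Bad-intro σ t∈σ p))
  ... | inj₂ (inj₁ ())
  ... | inj₂ (inj₂ (inj₁ (x∈ , yz∈))) with ∈-pairs-∷⁻ {M} {v ∷ []} yz∈ | p
  ...   | inj₁ (refl , here refl) | inj₁ (refl , _) = inj₁ x∈
  ...   | inj₁ (refl , here refl) | inj₂ (refl , _) = ⊥-elim (<-irrefl refl (lookup σ<M x∈))
  ...   | inj₂ () | _
  Bad-append⇒Forbidden av b | (x , y , z) , t∈ , p | inj₂ (inj₂ (inj₂ (xy∈ , z∈))) with ∈-pairs⁻ {σ} xy∈ | z∈ | p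
  ... | x∈ , _ | here refl         | inj₁ (refl , _)   = ⊥-elim (<-irrefl refl (lookup σ<M x∈))
  ... | x∈ , _ | there (here refl) | inj₁ (refl , _)   = inj₁ x∈
  ... | x∈ , _ | here refl         | inj₂ (refl , M<x) = ⊥-elim (<-asym M<x (lookup σ<M x∈))
  ... | x∈ , _ | there (here refl) | inj₂ (refl , v<x) = inj₂ (x , xy∈ , v<x)

  Forbidden⇒Bad-append : Forbidden σ v → Bad (σ ++ M ∷ v ∷ [])
  Forbidden⇒Bad-append (inj₁ v∈) =
    Bad-intro (σ ++ M ∷ v ∷ []) (∈-triples-++⁺₁ σ v∈ (∈-pairs-∷⁺ˡ {M} {v ∷ []} (here refl))) (inj₁ (refl , lookup σ<M v∈))
  Forbidden⇒Bad-append (inj₂ (a , aa∈ , v<a)) =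
    Bad-intro (σ ++ M ∷ v ∷ []) (∈-triples-++⁺₂ σ aa∈ (there (here refl))) (inj₂ (refl , v<a))

forbiddenCount : List ℕ → ℕ → ℕ
forbiddenCount σ k = ∑[ v ∈ upTo k ] 𝟙 (forbidden? σ v)

forbiddenCount≡forb : ∀ σ k → Avoids σ → All (_< k) σ → forbiddenCount σ k ≡ forb σ
forbiddenCount≡forb []      k av σ<k =
  ∑-zero (upTo k) _ (λ v _ → 𝟙-no (forbidden? [] v) (λ { (inj₁ ()) ; (inj₂ (_ , () , _)) }))
forbiddenCount≡forb σ@(x ∷ _) k av σ<k = begin
  forbiddenCount σ k
    ≡⟨ ∑-upTo-vanishing (suc (maxL σ)) k _ max<k beyondMax ⟩
  forbiddenCount σ (suc (maxL σ))
    ≡⟨ ∑-upTo-cong (suc (maxL σ)) (λ v _ → 𝟙-cong (Forbidden⇒Bad-append σ M v σ<M) (Bad-append⇒Forbidden σ M v σ<M av) _ _) ⟩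
  ∑[ v ∈ upTo M ] 𝟙 (bad? (σ ++ M ∷ v ∷ []))
    ≡⟨ sym (length-filter≡∑ (λ v → bad? (σ ++ M ∷ v ∷ [])) (upTo M)) ⟩
  forb σ
    ∎
  where
  open ≡-Reasoning
  M : ℕ
  M = suc (maxL σ)
  σ<M : All (_< M) σ
  σ<M = tabulate (s≤s ∘ ∈⇒≤maxL)
  max<k : M ≤ k
  max<k with maxL≡0⊎∈ σ
  ... | inj₁ max≡0 rewrite max≡0 = ≤-trans (s≤s z≤n) (lookup σ<k (here refl))
  ... | inj₂ max∈  = lookup σ<k max∈
  beyondMax : ∀ v → M ≤ v → 𝟙 (forbidden? σ v) ≡ 0
  beyondMax v M≤v = 𝟙-no (forbidden? σ v) (λ fv → <⇒≱ M≤v (Forbidden⇒≤maxL σ v fv))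

module _ (α : List ℕ) (m : ℕ) (α<m : All (_< m) α) where

  Avoids-split⁻ : ∀ γ → Avoids (α ++ m ∷ γ) → Avoids (m ∷ γ) × All (¬_ ∘ Forbidden α) γ
  Avoids-split⁻ γ av = Avoids-++ʳ α (m ∷ γ) av , tabulate notForbidden
    where
    notForbidden : ∀ {x} → x ∈ γ → ¬ Forbidden α x
    notForbidden x∈γ (inj₁ x∈α) =
      av (Bad-intro (α ++ m ∷ γ) (∈-triples-++⁺₁ α x∈α (∈-pairs-∷⁺ˡ {m} {γ} x∈γ)) (inj₁ (refl , lookup α<m x∈α)))
    notForbidden x∈γ (inj₂ (a , aa∈ , x<a)) =
      av (Bad-intro (α ++ m ∷ γ) (∈-triples-++⁺₂ α aa∈ (there x∈γ)) (inj₂ (refl , x<a)))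

  Avoids-split⁺ : ∀ γ → Avoids α → Avoids (m ∷ γ) → All (¬_ ∘ Forbidden α) γ → Avoids (α ++ m ∷ γ)
  Avoids-split⁺ γ avα avmγ γ∉F b with Bad-elim (α ++ m ∷ γ) b
  ... | (x , y , z) , t∈ , p with ∈-triples-++⁻ α t∈
  ... | inj₁ t∈α   = avα (Bad-intro α t∈α p)
  ... | inj₂ (inj₁ t∈mγ) = avmγ (Bad-intro (m ∷ γ) t∈mγ p)
  ... | inj₂ (inj₂ (inj₁ (x∈α , yz∈))) with ∈-pairs⁻ {m ∷ γ} yz∈ | p
  ...   | _ , here refl   | inj₁ (refl , _) = <-irrefl refl (lookup α<m x∈α)
  ...   | _ , there z∈γ   | inj₁ (refl , _) = lookup γ∉F z∈γ (inj₁ x∈α)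
  ...   | here refl , _   | inj₂ (refl , _) = <-irrefl refl (lookup α<m x∈α)
  ...   | there y∈γ , _   | inj₂ (refl , _) = lookup γ∉F y∈γ (inj₁ x∈α)
  Avoids-split⁺ γ avα avmγ γ∉F b | (x , y , z) , t∈ , p | inj₂ (inj₂ (inj₂ (xy∈α , z∈))) with ∈-pairs⁻ {α} xy∈α | z∈ | p
  ... | x∈α , _ | here refl   | inj₁ (refl , _)   = <-irrefl refl (lookup α<m x∈α)
  ... | x∈α , _ | there z∈γ   | inj₁ (refl , _)   = lookup γ∉F z∈γ (inj₁ x∈α)
  ... | x∈α , _ | here refl   | inj₂ (refl , m<x) = <-asym m<x (lookup α<m x∈α)
  ... | x∈α , _ | there z∈γ   | inj₂ (refl , z<x) = lookup γ∉F z∈γ (inj₂ (x , xy∈α , z<x))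

  Forbidden-split⁻ : ∀ γ → All (_< m) γ → All (¬_ ∘ Forbidden α) γ → ∀ v →
    Forbidden (α ++ m ∷ γ) v → Forbidden α v ⊎ v ≡ m ⊎ Forbidden γ v
  Forbidden-split⁻ γ γ<m γ∉F v (inj₁ v∈) with ∈-++⁻ α v∈
  ... | inj₁ v∈α = inj₁ (inj₁ v∈α)
  ... | inj₂ (here refl) = inj₂ (inj₁ refl)
  ... | inj₂ (there v∈γ) = inj₂ (inj₂ (inj₁ v∈γ))
  Forbidden-split⁻ γ γ<m γ∉F v (inj₂ (a , aa∈ , v<a)) with ∈-pairs-++⁻ α aa∈
  ... | inj₁ aa∈α = inj₁ (inj₂ (a , aa∈α , v<a))
  ... | inj₂ (inj₂ (a∈α , here refl)) = ⊥-elim (<-irrefl refl (lookup α<m a∈α))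
  ... | inj₂ (inj₂ (a∈α , there a∈γ)) = ⊥-elim (lookup γ∉F a∈γ (inj₁ a∈α))
  ... | inj₂ (inj₁ aa∈mγ) with ∈-pairs-∷⁻ {m} {γ} aa∈mγ
  ...   | inj₁ (refl , a∈γ) = ⊥-elim (<-irrefl refl (lookup γ<m a∈γ))
  ...   | inj₂ aa∈γ = inj₂ (inj₂ (inj₂ (a , aa∈γ , v<a)))

Forbidden-split⁺ : ∀ α m γ v → Forbidden α v ⊎ v ≡ m ⊎ Forbidden γ v → Forbidden (α ++ m ∷ γ) v
Forbidden-split⁺ α m γ v (inj₁ (inj₁ v∈α)) = inj₁ (∈-++⁺ˡ v∈α)
Forbidden-split⁺ α m γ v (inj₁ (inj₂ (a , aa∈ , v<a))) = inj₂ (a , ∈-pairs-++⁺ˡ α aa∈ , v<a)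
Forbidden-split⁺ α m γ v (inj₂ (inj₁ refl)) = inj₁ (∈-++⁺ʳ α (here refl))
Forbidden-split⁺ α m γ v (inj₂ (inj₂ (inj₁ v∈γ))) = inj₁ (∈-++⁺ʳ α (there v∈γ))
Forbidden-split⁺ α m γ v (inj₂ (inj₂ (inj₂ (a , aa∈ , v<a)))) =
  inj₂ (a , ∈-pairs-++⁺ʳ α (∈-pairs-∷⁺ʳ {m} {γ} aa∈) , v<a)

Forbidden-repeated : ∀ α m β γ v → v ≤ m → Forbidden (α ++ m ∷ β ++ m ∷ γ) v
Forbidden-repeated α m β γ v v≤m with v ≟ m
... | yes refl = inj₁ (∈-++⁺ʳ α (here refl))
... | no v≢m   = inj₂ (m , ∈-pairs-++⁺ʳ α (∈-pairs-∷⁺ˡ {m} {β ++ m ∷ γ} (∈-++⁺ʳ β (here refl))) , ≤∧≢⇒< v≤m v≢m)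

Avoids-∷-above : ∀ m γ → All (_< m) γ → Avoids γ → Avoids (m ∷ γ)
Avoids-∷-above m γ γ<m avγ b with Bad-elim (m ∷ γ) b
... | (x , y , z) , t∈ , p with ∈-triples-∷⁻ {m} {γ} t∈ | p
... | inj₂ t∈γ         | _               = avγ (Bad-intro γ t∈γ p)
... | inj₁ (refl , yz∈) | inj₁ (refl , _) = <-irrefl refl (lookup γ<m (proj₂ (∈-pairs⁻ {γ} yz∈)))
... | inj₁ (refl , yz∈) | inj₂ (refl , _) = <-irrefl refl (lookup γ<m (proj₁ (∈-pairs⁻ {γ} yz∈)))

¬Pattern-constant : ∀ {m x y z} → x ≡ m → y ≡ m → z ≡ m → ¬ Pattern (x , y , z)
¬Pattern-constant refl refl refl (inj₁ (_ , m<m)) = <-irrefl refl m<m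
¬Pattern-constant refl refl refl (inj₂ (_ , m<m)) = <-irrefl refl m<m

module _ (m : ℕ) (β γ : List ℕ) where

  Avoids-repeat⁻ : All (_≤ m) γ → Avoids (m ∷ β ++ m ∷ γ) → Avoids β × All (_≡ m) γ
  Avoids-repeat⁻ γ≤m av = Avoids-++ˡ β (m ∷ γ) (Avoids-∷ m (β ++ m ∷ γ) av) , tabulate ≡m
    where
    ≡m : ∀ {z} → z ∈ γ → z ≡ m
    ≡m {z} z∈γ with z ≟ m
    ... | yes z≡m = z≡m
    ... | no z≢m  = ⊥-elim (av (Bad-intro (m ∷ β ++ m ∷ γ)
            (∈-triples-∷⁺ˡ {m} {β ++ m ∷ γ} (∈-pairs-++⁺ʳ β (∈-pairs-∷⁺ˡ {m} {γ} z∈γ)))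
            (inj₂ (refl , ≤∧≢⇒< (lookup γ≤m z∈γ) z≢m))))

  module _ (β<m : All (_< m) β) (γ≡m : All (_≡ m) γ) where

    private
      ≡m : ∀ {w} → w ∈ m ∷ γ → w ≡ m
      ≡m = lookup (refl ∷ γ≡m)

      ≤m : ∀ {w} → w ∈ β ++ m ∷ γ → w ≤ m
      ≤m w∈ with ∈-++⁻ β w∈
      ... | inj₁ w∈β  = <⇒≤ (lookup β<m w∈β)
      ... | inj₂ w∈mγ = ≤-reflexive (≡m w∈mγ)

      ¬Pattern-head : ∀ {y z} → (y , z) ∈ pairs (β ++ m ∷ γ) → ¬ Pattern (m , y , z)
      ¬Pattern-head yz∈ (inj₁ (refl , m<y)) = <⇒≱ m<y (≤m (proj₁ (∈-pairs⁻ {β ++ m ∷ γ} yz∈)))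
      ¬Pattern-head yz∈ (inj₂ (refl , z<m)) with ∈-pairs-++⁻ β yz∈
      ... | inj₁ mz∈β = <-irrefl refl (lookup β<m (proj₁ (∈-pairs⁻ {β} mz∈β)))
      ... | inj₂ (inj₂ (m∈β , _)) = <-irrefl refl (lookup β<m m∈β)
      ... | inj₂ (inj₁ mz∈mγ) = <-irrefl (≡m (proj₂ (∈-pairs⁻ {m ∷ γ} mz∈mγ))) z<m

    Avoids-repeat⁺ : Avoids β → Avoids (m ∷ β ++ m ∷ γ)
    Avoids-repeat⁺ avβ b with Bad-elim (m ∷ β ++ m ∷ γ) b
    ... | (x , y , z) , t∈ , p with ∈-triples-∷⁻ {m} {β ++ m ∷ γ} t∈
    ... | inj₁ (refl , yz∈) = ¬Pattern-head yz∈ p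
    ... | inj₂ t∈′ with ∈-triples-++⁻ β t∈′ | p
    ...   | inj₁ t∈β | _ = avβ (Bad-intro β t∈β p)
    ...   | inj₂ (inj₁ t∈mγ) | _ = let x∈ , y∈ , z∈ = ∈-triples⁻ {m ∷ γ} t∈mγ in
                                   ¬Pattern-constant (≡m x∈) (≡m y∈) (≡m z∈) p
    ...   | inj₂ (inj₂ (inj₁ (x∈β , yz∈))) | inj₁ (refl , _) = <-irrefl (≡m (proj₂ (∈-pairs⁻ {m ∷ γ} yz∈))) (lookup β<m x∈β)
    ...   | inj₂ (inj₂ (inj₁ (x∈β , yz∈))) | inj₂ (refl , _) = <-irrefl (≡m (proj₁ (∈-pairs⁻ {m ∷ γ} yz∈))) (lookup β<m x∈β)
    ...   | inj₂ (inj₂ (inj₂ (xy∈β , z∈))) | inj₁ (refl , _) = <-irrefl (≡m z∈) (lookup β<m (proj₁ (∈-pairs⁻ {β} xy∈β)))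
    ...   | inj₂ (inj₂ (inj₂ (xy∈β , z∈))) | inj₂ (refl , z<x) =
      <-asym (subst (_< x) (≡m z∈) z<x) (lookup β<m (proj₁ (∈-pairs⁻ {β} xy∈β)))

module OrderEmbedding (c : ℕ) (ψ : ℕ → ℕ) (ψ-mono : ∀ {x y} → x < c → y < c → x < y → ψ x < ψ y) where

  ψ-reflects-< : ∀ {x y} → x < c → y < c → ψ x < ψ y → x < y
  ψ-reflects-< {x} {y} x<c y<c ψx<ψy with <-cmp x y
  ... | tri< x<y _ _ = x<y
  ... | tri≈ _ refl _ = ⊥-elim (<-irrefl refl ψx<ψy)
  ... | tri> _ _ y<x = ⊥-elim (<-asym ψx<ψy (ψ-mono y<c x<c y<x))

  ψ-injective : ∀ {x y} → x < c → y < c → ψ x ≡ ψ y → x ≡ y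
  ψ-injective {x} {y} x<c y<c ψx≡ψy with <-cmp x y
  ... | tri< x<y _ _ = ⊥-elim (<-irrefl ψx≡ψy (ψ-mono x<c y<c x<y))
  ... | tri≈ _ x≡y _ = x≡y
  ... | tri> _ _ y<x = ⊥-elim (<-irrefl (sym ψx≡ψy) (ψ-mono y<c x<c y<x))

  module _ (β : List ℕ) (β<c : All (_< c) β) where

    Forbidden-map⁻ : ∀ y → y < c → Forbidden (map ψ β) (ψ y) → Forbidden β y
    Forbidden-map⁻ y y<c (inj₁ ψy∈) with ∈-map⁻ ψ ψy∈
    ... | y′ , y′∈ , ψy≡ψy′ = inj₁ (subst (_∈ β) (sym (ψ-injective y<c (lookup β<c y′∈) ψy≡ψy′)) y′∈)
    Forbidden-map⁻ y y<c (inj₂ (a , aa∈ , ψy<a)) with ∈-pairs-map⁻ ψ β aa∈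
    ... | x′ , x″ , xx∈ , refl , ψx′≡ψx″ with ∈-pairs⁻ {β} xx∈
    ...   | x′∈ , x″∈ with ψ-injective (lookup β<c x′∈) (lookup β<c x″∈) ψx′≡ψx″
    ...     | refl = inj₂ (x′ , xx∈ , ψ-reflects-< y<c (lookup β<c x′∈) ψy<a)

    Forbidden-map⁺ : ∀ y → y < c → Forbidden β y → Forbidden (map ψ β) (ψ y)
    Forbidden-map⁺ y y<c (inj₁ y∈) = inj₁ (∈-map⁺ ψ y∈)
    Forbidden-map⁺ y y<c (inj₂ (a , aa∈ , y<a)) =
      inj₂ (ψ a , ∈-pairs-map⁺ ψ β aa∈ , ψ-mono y<c (lookup β<c (proj₁ (∈-pairs⁻ {β} aa∈))) y<a)

    Avoids-map⁻ : Avoids (map ψ β) → Avoids β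
    Avoids-map⁻ av b with Bad-elim β b
    ... | (x , y , z) , t∈ , p with ∈-triples⁻ {β} t∈
    ... | x∈ , y∈ , z∈ = av (Bad-intro (map ψ β) (∈-triples-map⁺ ψ β t∈) (image p))
      where
      image : Pattern (x , y , z) → Pattern (ψ x , ψ y , ψ z)
      image (inj₁ (refl , x<y)) = inj₁ (refl , ψ-mono (lookup β<c x∈) (lookup β<c y∈) x<y)
      image (inj₂ (refl , z<x)) = inj₂ (refl , ψ-mono (lookup β<c z∈) (lookup β<c x∈) z<x)

    Avoids-map⁺ : Avoids β → Avoids (map ψ β)
    Avoids-map⁺ av b with Bad-elim (map ψ β) b
    ... | _ , t∈ , p with ∈-triples-map⁻ ψ β t∈
    ... | x , y , z , t∈β , refl , refl , refl with ∈-triples⁻ {β} t∈β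
    ... | x∈ , y∈ , z∈ = av (Bad-intro β t∈β (preimage p))
      where
      preimage : Pattern (ψ x , ψ y , ψ z) → Pattern (x , y , z)
      preimage (inj₁ (ψx≡ψz , ψx<ψy)) =
        inj₁ (ψ-injective (lookup β<c x∈) (lookup β<c z∈) ψx≡ψz , ψ-reflects-< (lookup β<c x∈) (lookup β<c y∈) ψx<ψy)
      preimage (inj₂ (ψx≡ψy , ψz<ψx)) =
        inj₂ (ψ-injective (lookup β<c x∈) (lookup β<c y∈) ψx≡ψy , ψ-reflects-< (lookup β<c z∈) (lookup β<c x∈) ψz<ψx)

nth : List ℕ → ℕ → ℕ
nth []       _       = 0
nth (x ∷ xs) zero    = x
nth (x ∷ xs) (suc k) = nth xs k

∑≡∑-nth : (xs : List ℕ) (g : ℕ → ℕ) → ∑ xs g ≡ ∑[ y ∈ upTo (length xs) ] g (nth xs y)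
∑≡∑-nth []       g = refl
∑≡∑-nth (x ∷ xs) g =
  trans (cong (g x +_) (∑≡∑-nth xs g)) (sym (∑-upTo-suc (length xs) (λ y → g (nth (x ∷ xs) y))))

nth∈ : (xs : List ℕ) {y : ℕ} → y < length xs → nth xs y ∈ xs
nth∈ (x ∷ xs) {zero}  _         = here refl
nth∈ (x ∷ xs) {suc y} (s≤s y<) = there (nth∈ xs y<)

nth-mono : (xs : List ℕ) → AllPairs _<_ xs → ∀ {y y′} → y < y′ → y′ < length xs → nth xs y < nth xs y′
nth-mono (x ∷ xs) (x< ∷ _)   {zero}  {suc y′} _         (s≤s y′<) = lookup x< (nth∈ xs y′<)
nth-mono (x ∷ xs) (_ ∷ xs<) {suc y} {suc y′} (s≤s y<y′) (s≤s y′<) = nth-mono xs xs< y<y′ y′<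

IsInvFrom-++⁺ : ∀ k u v → IsInvFrom k u → IsInvFrom (k + length u) v → IsInvFrom k (u ++ v)
IsInvFrom-++⁺ k []      v _          inv-v = subst (λ j → IsInvFrom j v) (+-identityʳ k) inv-v
IsInvFrom-++⁺ k (x ∷ u) v (x< , inv-u) inv-v =
  x< , IsInvFrom-++⁺ (suc k) u v inv-u (subst (λ j → IsInvFrom j v) (+-suc k (length u)) inv-v)

IsInvFrom-++⁻ : ∀ k u v → IsInvFrom k (u ++ v) → IsInvFrom k u × IsInvFrom (k + length u) v
IsInvFrom-++⁻ k []      v inv = tt , subst (λ j → IsInvFrom j v) (sym (+-identityʳ k)) inv
IsInvFrom-++⁻ k (x ∷ u) v (x< , inv) =
  let inv-u , inv-v = IsInvFrom-++⁻ (suc k) u v inv in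
  (x< , inv-u) , subst (λ j → IsInvFrom j v) (sym (+-suc k (length u))) inv-v

All<⇒IsInvFrom : ∀ k v → All (_< k) v → IsInvFrom k v
All<⇒IsInvFrom k []      []         = tt
All<⇒IsInvFrom k (x ∷ v) (x< ∷ v<) = x< , All<⇒IsInvFrom (suc k) v (All.map m<n⇒m<1+n v<)

IsInvFrom⇒All< : ∀ k w → IsInvFrom (suc k) w → All (_< k + length w) w
IsInvFrom⇒All< k []      _                  = []
IsInvFrom⇒All< k (x ∷ w) (s≤s x≤k , inv-w) =
  subst (λ j → All (_< j) (x ∷ w)) (sym (+-suc k (length w)))
    (s≤s (≤-trans x≤k (m≤m+n k (length w))) ∷ IsInvFrom⇒All< (suc k) w inv-w)

a+b+1≡o⇒a<o×b≡o∸a∸1 : ∀ {a b o} → a + b + 1 ≡ o → a < o × b ≡ o ∸ a ∸ 1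
a+b+1≡o⇒a<o×b≡o∸a∸1 {a} {b} refl =
  ≤-trans (s≤s (m≤m+n a b)) (≤-reflexive (+-comm 1 (a + b))) ,
  sym (trans (cong (_∸ 1) (trans (cong (_∸ a) (+-assoc a b 1)) (m+n∸m≡n a (b + 1)))) (m+n∸n≡m b 1))

a<o⇒a+[o∸a∸1]+1≡o : ∀ {a o} → a < o → a + (o ∸ a ∸ 1) + 1 ≡ o
a<o⇒a+[o∸a∸1]+1≡o {a} {o} a<o =
  trans (+-assoc a (o ∸ a ∸ 1) 1) (trans (cong (a +_) (m∸n+n≡m (m<n⇒0<n∸m a<o))) (m+[n∸m]≡n (<⇒≤ a<o)))

module Suffixes (α : List ℕ) (m f K : ℕ) (avα : Avoids α) (α<m : All (_< m) α) (m<K : m < K) where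

  i : ℕ
  i = forb α

  free? : ∀ v → Dec (¬ Forbidden α v)
  free? v = ¬? (forbidden? α v)

  Allowed : ℕ → Set
  Allowed v = v < m × ¬ Forbidden α v

  allowed? : ∀ v → Dec (Allowed v)
  allowed? v = (v <? m) ×-dec free? v

  freeLetters : List ℕ
  freeLetters = filter free? (upTo m)

  c : ℕ
  c = length freeLetters

  ψ : ℕ → ℕ
  ψ = nth freeLetters

  ψ-free : ∀ {y} → y < c → Allowed (ψ y)
  ψ-free y<c = let ψy∈ , ψy-free = ∈-filter⁻ free? {xs = upTo m} (nth∈ freeLetters y<c) in ∈-upTo⁻ ψy∈ , ψy-free

  ψ-mono : ∀ {x y} → x < c → y < c → x < y → ψ x < ψ y
  ψ-mono _ y<c x<y = nth-mono freeLetters (AllPairs.filter⁺ free? (AllPairs.applyUpTo⁺₁ id m (λ i<j _ → i<j))) x<y y<c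

  open OrderEmbedding c ψ ψ-mono

  ∑-free : (g : ℕ → ℕ) → ∑[ v ∈ upTo m ] (𝟙 (free? v) * g v) ≡ ∑[ y ∈ upTo c ] g (ψ y)
  ∑-free g = trans (sym (∑-filter free? (upTo m) g)) (∑≡∑-nth freeLetters g)

  ∑-allowed : (g : ℕ → ℕ) → ∑[ v ∈ upTo K ] (𝟙 (allowed? v) * g v) ≡ ∑[ y ∈ upTo c ] g (ψ y)
  ∑-allowed g = begin
    ∑[ v ∈ upTo K ] (𝟙 (allowed? v) * g v)
      ≡⟨ ∑-upTo-vanishing m K _ (<⇒≤ m<K) (λ v m≤v → cong (_* g v) (𝟙-no (allowed? v) (λ (v<m , _) → <⇒≱ v<m m≤v))) ⟩
    ∑[ v ∈ upTo m ] (𝟙 (allowed? v) * g v)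
      ≡⟨ ∑-upTo-cong m (λ v v<m → cong (_* g v) (𝟙-cong proj₂ (v<m ,_) (allowed? v) (free? v))) ⟩
    ∑[ v ∈ upTo m ] (𝟙 (free? v) * g v)
      ≡⟨ ∑-free g ⟩
    ∑[ y ∈ upTo c ] g (ψ y)
      ∎
    where open ≡-Reasoning

  c+i≡m : c + i ≡ m
  c+i≡m = begin
    c + i
      ≡⟨ cong₂ _+_ (length-filter≡∑ free? (upTo m)) (sym (forbiddenCount≡forb α m avα α<m)) ⟩
    ∑[ v ∈ upTo m ] 𝟙 (free? v) + forbiddenCount α m
      ≡⟨ ∑-𝟙¬+∑-𝟙≡length (forbidden? α) (upTo m) ⟩
    length (upTo m)
      ≡⟨ length-upTo m ⟩
    m
      ∎
    where open ≡-Reasoning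

  c≡m∸i : c ≡ m ∸ i
  c≡m∸i = trans (sym (m+n∸n≡m c i)) (cong (_∸ i) c+i≡m)

  i≤m : i ≤ m
  i≤m = subst (i ≤_) c+i≡m (m≤n+m i c)

  χ : List ℕ → ℕ
  χ γ = 𝟙 (avoids? (α ++ m ∷ γ) ×-dec (forb (α ++ m ∷ γ) ≟ f))

  module _ (β : List ℕ) (β<c : All (_< c) β) where

    private
      ψβ-free : All Allowed (map ψ β)
      ψβ-free = All.map⁺ (All.map ψ-free β<c)

      ψβ<m : All (_< m) (map ψ β)
      ψβ<m = All.map proj₁ ψβ-free

    Avoids-free-suffix⁺ : Avoids β → Avoids (α ++ m ∷ map ψ β)
    Avoids-free-suffix⁺ avβ =
      Avoids-split⁺ α m α<m (map ψ β) avα (Avoids-∷-above m (map ψ β) ψβ<m (Avoids-map⁺ β β<c avβ)) (All.map proj₂ ψβ-free)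

    Avoids-free-suffix⁻ : Avoids (α ++ m ∷ map ψ β) → Avoids β
    Avoids-free-suffix⁻ av = Avoids-map⁻ β β<c (Avoids-∷ m (map ψ β) (proj₁ (Avoids-split⁻ α m α<m (map ψ β) av)))

    𝟙-forbidden-free-suffix : ∀ v → v < m →
      𝟙 (forbidden? (α ++ m ∷ map ψ β) v) ≡ 𝟙 (forbidden? α v) + 𝟙 (free? v) * 𝟙 (forbidden? (map ψ β) v)
    𝟙-forbidden-free-suffix v v<m with forbidden? α v
    ... | yes fv = 𝟙-yes (forbidden? (α ++ m ∷ map ψ β) v) (Forbidden-split⁺ α m (map ψ β) v (inj₁ fv))
    ... | no ¬fv = trans
      (𝟙-cong toSuffix (λ fv′ → Forbidden-split⁺ α m (map ψ β) v (inj₂ (inj₂ fv′))) _ (forbidden? (map ψ β) v))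
      (sym (+-identityʳ _))
      where
      toSuffix : Forbidden (α ++ m ∷ map ψ β) v → Forbidden (map ψ β) v
      toSuffix fv′ with Forbidden-split⁻ α m α<m (map ψ β) ψβ<m (All.map proj₂ ψβ-free) v fv′
      ... | inj₁ fv            = ⊥-elim (¬fv fv)
      ... | inj₂ (inj₁ refl)   = ⊥-elim (<-irrefl refl v<m)
      ... | inj₂ (inj₂ fv-suf) = fv-suf

    forb-free-suffix : Avoids β → forb (α ++ m ∷ map ψ β) ≡ i + forb β + 1
    forb-free-suffix avβ = begin
      forb σ
        ≡⟨ sym (forbiddenCount≡forb σ (suc m) (Avoids-free-suffix⁺ avβ) σ<1+m) ⟩
      forbiddenCount σ (suc m)
        ≡⟨ ∑-upTo-snoc m _ ⟩
      forbiddenCount σ m + 𝟙 (forbidden? σ m)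
        ≡⟨ cong₂ _+_ (∑-upTo-cong m 𝟙-forbidden-free-suffix) (𝟙-yes (forbidden? σ m) (inj₁ (∈-++⁺ʳ α (here refl)))) ⟩
      ∑[ v ∈ upTo m ] (𝟙 (forbidden? α v) + 𝟙 (free? v) * 𝟙 (forbidden? (map ψ β) v)) + 1
        ≡⟨ cong (_+ 1) (∑-+ (upTo m) _ _) ⟩
      forbiddenCount α m + ∑[ v ∈ upTo m ] (𝟙 (free? v) * 𝟙 (forbidden? (map ψ β) v)) + 1
        ≡⟨ cong (λ k → k + 1) (cong₂ _+_ (forbiddenCount≡forb α m avα α<m) (∑-free _)) ⟩
      i + ∑[ y ∈ upTo c ] 𝟙 (forbidden? (map ψ β) (ψ y)) + 1
        ≡⟨ cong (λ k → i + k + 1) (∑-upTo-cong c (λ y y<c → 𝟙-cong (Forbidden-map⁻ β β<c y y<c) (Forbidden-map⁺ β β<c y y<c) _ _)) ⟩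
      i + forbiddenCount β c + 1
        ≡⟨ cong (λ k → i + k + 1) (forbiddenCount≡forb β c avβ β<c) ⟩
      i + forb β + 1
        ∎
      where
      open ≡-Reasoning
      σ : List ℕ
      σ = α ++ m ∷ map ψ β
      σ<1+m : All (_< suc m) σ
      σ<1+m = All.++⁺ (All.map m<n⇒m<1+n α<m) (≤-refl ∷ All.map m<n⇒m<1+n ψβ<m)

    χ-free-suffix : χ (map ψ β) ≡ 𝟙 (i <? f) * 𝟙 (avoids? β ×-dec (forb β ≟ f ∸ i ∸ 1))
    χ-free-suffix = trans (𝟙-cong to from _ ((i <? f) ×-dec _)) (𝟙-× (i <? f) _)
      where
      to : Avoids (α ++ m ∷ map ψ β) × forb (α ++ m ∷ map ψ β) ≡ f → i < f × Avoids β × forb β ≡ f ∸ i ∸ 1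
      to (av , forb≡f) =
        let avβ          = Avoids-free-suffix⁻ av
            i<f , forbβ≡ = a+b+1≡o⇒a<o×b≡o∸a∸1 (trans (sym (forb-free-suffix avβ)) forb≡f)
        in  i<f , avβ , forbβ≡
      from : i < f × Avoids β × forb β ≡ f ∸ i ∸ 1 → Avoids (α ++ m ∷ map ψ β) × forb (α ++ m ∷ map ψ β) ≡ f
      from (i<f , avβ , forbβ≡) = Avoids-free-suffix⁺ avβ ,
        trans (forb-free-suffix avβ) (trans (cong (λ b → i + b + 1) forbβ≡) (a<o⇒a+[o∸a∸1]+1≡o i<f))

  ∑-free-suffixes : ∀ L → ∑[ γ ∈ words K L ] (𝟙 (all? allowed? γ) * χ γ) ≡ 𝟙 (i <? f) * jcount L c (f ∸ i ∸ 1)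
  ∑-free-suffixes L = begin
    ∑[ γ ∈ words K L ] (𝟙 (all? allowed? γ) * χ γ)
      ≡⟨ ∑-words-relabel allowed? K c ψ ∑-allowed L χ ⟩
    ∑[ β ∈ words c L ] χ (map ψ β)
      ≡⟨ ∑-words-cong c L (λ β _ β<c → χ-free-suffix β β<c) ⟩
    ∑[ β ∈ words c L ] (𝟙 (i <? f) * 𝟙 (avoids? β ×-dec (forb β ≟ f ∸ i ∸ 1)))
      ≡⟨ ∑-*ˡ (words c L) (𝟙 (i <? f)) _ ⟩
    𝟙 (i <? f) * ∑[ β ∈ words c L ] 𝟙 (avoids? β ×-dec (forb β ≟ f ∸ i ∸ 1))
      ≡⟨ cong (𝟙 (i <? f) *_) (sym (length-filter≡∑ _ (words c L))) ⟩
    𝟙 (i <? f) * jcount L c (f ∸ i ∸ 1)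
      ∎
    where open ≡-Reasoning

  ∑-allowed-avoiders : ∀ N → ∑[ β ∈ words K N ] (𝟙 (all? allowed? β) * 𝟙 (avoids? β)) ≡ kcount N c
  ∑-allowed-avoiders N = begin
    ∑[ β ∈ words K N ] (𝟙 (all? allowed? β) * 𝟙 (avoids? β))
      ≡⟨ ∑-words-relabel allowed? K c ψ ∑-allowed N (λ β → 𝟙 (avoids? β)) ⟩
    ∑[ β ∈ words c N ] 𝟙 (avoids? (map ψ β))
      ≡⟨ ∑-words-cong c N (λ β _ β<c → 𝟙-cong (Avoids-map⁻ β β<c) (Avoids-map⁺ β β<c) _ _) ⟩
    ∑[ β ∈ words c N ] 𝟙 (avoids? β)
      ≡⟨ sym (length-filter≡∑ avoids? (words c N)) ⟩
    kcount N c
      ∎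
    where open ≡-Reasoning

  -- A second m forbids every letter up to m.
  forb-repeat : ∀ β γ → Avoids (α ++ m ∷ β ++ m ∷ γ) → All (_≤ m) (β ++ m ∷ γ) → forb (α ++ m ∷ β ++ m ∷ γ) ≡ suc m
  forb-repeat β γ av ≤m = begin
    forb σ                      ≡⟨ sym (forbiddenCount≡forb σ (suc m) av σ<1+m) ⟩
    forbiddenCount σ (suc m)    ≡⟨ ∑-upTo-cong (suc m) (λ v v<1+m → 𝟙-yes (forbidden? σ v) (Forbidden-repeated α m β γ v (≤-pred v<1+m))) ⟩
    ∑[ _ ∈ upTo (suc m) ] 1     ≡⟨ ∑-1≡length (upTo (suc m)) ⟩
    length (upTo (suc m))       ≡⟨ length-upTo (suc m) ⟩
    suc m                       ∎
    where
    open ≡-Reasoning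
    σ : List ℕ
    σ = α ++ m ∷ β ++ m ∷ γ
    σ<1+m : All (_< suc m) σ
    σ<1+m = All.++⁺ (All.map m<n⇒m<1+n α<m) (≤-refl ∷ All.map s≤s ≤m)

  χ-repeat : ∀ β γ →
    𝟙 (m ∉? β) * (𝟙 (all? (_≤? m) (β ++ m ∷ γ)) * χ (β ++ m ∷ γ)) ≡
    (𝟙 (all? allowed? β) * 𝟙 (avoids? β)) * (𝟙 (all? (_≟ m) γ) * 𝟙 (f ≟ suc m))
  χ-repeat β γ = begin
    𝟙 d₁ * (𝟙 d₂ * 𝟙 d₃)             ≡⟨ cong (𝟙 d₁ *_) (sym (𝟙-× d₂ d₃)) ⟩
    𝟙 d₁ * 𝟙 (d₂ ×-dec d₃)           ≡⟨ sym (𝟙-× d₁ _) ⟩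
    𝟙 (d₁ ×-dec d₂ ×-dec d₃)         ≡⟨ 𝟙-cong to from _ ((e₁ ×-dec e₂) ×-dec (e₃ ×-dec e₄)) ⟩
    𝟙 ((e₁ ×-dec e₂) ×-dec (e₃ ×-dec e₄)) ≡⟨ 𝟙-× (e₁ ×-dec e₂) _ ⟩
    𝟙 (e₁ ×-dec e₂) * 𝟙 (e₃ ×-dec e₄) ≡⟨ cong₂ _*_ (𝟙-× e₁ e₂) (𝟙-× e₃ e₄) ⟩
    𝟙 e₁ * 𝟙 e₂ * (𝟙 e₃ * 𝟙 e₄)      ∎
    where
    open ≡-Reasoning
    w : List ℕ
    w = β ++ m ∷ γ
    d₁ : Dec (m ∉ β)
    d₁ = m ∉? β
    d₂ : Dec (All (_≤ m) w)
    d₂ = all? (_≤? m) w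
    d₃ : Dec (Avoids (α ++ m ∷ w) × forb (α ++ m ∷ w) ≡ f)
    d₃ = avoids? (α ++ m ∷ w) ×-dec (forb (α ++ m ∷ w) ≟ f)
    e₁ : Dec (All Allowed β)
    e₁ = all? allowed? β
    e₂ : Dec (Avoids β)
    e₂ = avoids? β
    e₃ : Dec (All (_≡ m) γ)
    e₃ = all? (_≟ m) γ
    e₄ : Dec (f ≡ suc m)
    e₄ = f ≟ suc m
    to : m ∉ β × All (_≤ m) w × Avoids (α ++ m ∷ w) × forb (α ++ m ∷ w) ≡ f →
         (All Allowed β × Avoids β) × (All (_≡ m) γ × f ≡ suc m)
    to (m∉β , w≤m , av , forb≡f) =
      let avmw , w-free = Avoids-split⁻ α m α<m w av
          avβ , γ≡m = Avoids-repeat⁻ m β γ (All.tail (All.++⁻ʳ β w≤m)) avmw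
          β-allowed = tabulate (λ {x} x∈β → ≤∧≢⇒< (lookup (All.++⁻ˡ β w≤m) x∈β) (λ { refl → m∉β x∈β }) ,
                                             lookup (All.++⁻ˡ β w-free) x∈β)
      in (β-allowed , avβ) , (γ≡m , trans (sym forb≡f) (forb-repeat β γ av w≤m))
    from : (All Allowed β × Avoids β) × (All (_≡ m) γ × f ≡ suc m) →
           m ∉ β × All (_≤ m) w × Avoids (α ++ m ∷ w) × forb (α ++ m ∷ w) ≡ f
    from ((β-allowed , avβ) , (γ≡m , f≡1+m)) = m∉β , w≤m , av , trans (forb-repeat β γ av w≤m) (sym f≡1+m)
      where
      m∉β : m ∉ β
      m∉β m∈β = <-irrefl refl (proj₁ (lookup β-allowed m∈β))
      w≤m : All (_≤ m) w
      w≤m = All.++⁺ (All.map (<⇒≤ ∘ proj₁) β-allowed) (≤-refl ∷ All.map ≤-reflexive γ≡m)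
      m-free : ¬ Forbidden α m
      m-free fm = <-irrefl refl (Forbidden-< α m α<m fm)
      av : Avoids (α ++ m ∷ w)
      av = Avoids-split⁺ α m α<m w avα (Avoids-repeat⁺ m β γ (All.map proj₁ β-allowed) γ≡m avβ)
             (All.++⁺ (All.map proj₂ β-allowed) (m-free ∷ All.map (λ { refl → m-free }) γ≡m))

  ∑-repeat-suffixes : ∀ L →
    ∑[ γ ∈ words K L ] (𝟙 (m ∈? γ) * (𝟙 (all? (_≤? m) γ) * χ γ)) ≡ 𝟙 (f ≟ suc m) * ∑[ ℓ ∈ upTo L ] kcount ℓ c
  ∑-repeat-suffixes L = begin
    ∑[ γ ∈ words K L ] (𝟙 (m ∈? γ) * g γ)
      ≡⟨ ∑-words-∈ L g ⟩
    ∑[ a ∈ upTo L ] firstAt (L ∸ suc a) g a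
      ≡⟨ ∑-cong (upTo L) (λ a → ∑-cong (words K a) (λ β → prefixTotal (L ∸ suc a) β)) ⟩
    ∑[ a ∈ upTo L ] ∑[ β ∈ words K a ] (H β * C)
      ≡⟨ ∑-cong (upTo L) (λ a → trans (∑-*ʳ (words K a) C H) (cong (_* C) (∑-allowed-avoiders a))) ⟩
    ∑[ a ∈ upTo L ] (kcount a c * C)
      ≡⟨ ∑-*ʳ (upTo L) C (λ a → kcount a c) ⟩
    ∑[ a ∈ upTo L ] kcount a c * C
      ≡⟨ *-comm _ C ⟩
    C * ∑[ ℓ ∈ upTo L ] kcount ℓ c
      ∎
    where
    open ≡-Reasoning
    open FirstOccurrence m K m<K
    g : List ℕ → ℕ
    g γ = 𝟙 (all? (_≤? m) γ) * χ γ
    H : List ℕ → ℕ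
    H β = 𝟙 (all? allowed? β) * 𝟙 (avoids? β)
    C : ℕ
    C = 𝟙 (f ≟ suc m)
    prefixTotal : ∀ N β → 𝟙 (m ∉? β) * ∑[ γ ∈ words K N ] g (β ++ m ∷ γ) ≡ H β * C
    prefixTotal N β = begin
      𝟙 (m ∉? β) * ∑[ γ ∈ words K N ] g (β ++ m ∷ γ)         ≡⟨ sym (∑-*ˡ (words K N) (𝟙 (m ∉? β)) _) ⟩
      ∑[ γ ∈ words K N ] (𝟙 (m ∉? β) * g (β ++ m ∷ γ))       ≡⟨ ∑-cong (words K N) (χ-repeat β) ⟩
      ∑[ γ ∈ words K N ] (H β * (𝟙 (all? (_≟ m) γ) * C))     ≡⟨ ∑-*ˡ (words K N) (H β) _ ⟩
      H β * ∑[ γ ∈ words K N ] (𝟙 (all? (_≟ m) γ) * C)       ≡⟨ cong (H β *_) (∑-*ʳ (words K N) C _) ⟩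
      H β * (∑[ γ ∈ words K N ] 𝟙 (all? (_≟ m) γ) * C)       ≡⟨ cong (λ k → H β * (k * C)) (∑-words-constant m K m<K N) ⟩
      H β * (1 * C)                                          ≡⟨ cong (H β *_) (*-identityˡ C) ⟩
      H β * C                                                ∎

  χ-split : ∀ γ → 𝟙 (all? (_≤? m) γ) * χ γ ≡ 𝟙 (all? allowed? γ) * χ γ + 𝟙 (m ∈? γ) * (𝟙 (all? (_≤? m) γ) * χ γ)
  χ-split γ with m ∈? γ
  ... | yes m∈γ rewrite 𝟙-no (all? allowed? γ) (λ γ-allowed → <-irrefl refl (proj₁ (lookup γ-allowed m∈γ))) =
    sym (+-identityʳ _)
  ... | no m∉γ with all? allowed? γ
  ...   | yes γ-allowed = trans (cong (_* χ γ) (𝟙-yes (all? (_≤? m) γ) (All.map (<⇒≤ ∘ proj₁) γ-allowed)))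
                                (sym (+-identityʳ _))
  ...   | no γ-not-allowed with all? (_≤? m) γ
  ...     | no _    = refl
  ...     | yes γ≤m = cong (1 *_) (𝟙-no (avoids? (α ++ m ∷ γ) ×-dec _) (λ (av , _) → γ-not-allowed (allowed av)))
    where
    allowed : Avoids (α ++ m ∷ γ) → All Allowed γ
    allowed av = tabulate (λ {x} x∈γ → ≤∧≢⇒< (lookup γ≤m x∈γ) (λ { refl → m∉γ x∈γ }) ,
                                       lookup (proj₂ (Avoids-split⁻ α m α<m γ av)) x∈γ)

  ∑-suffixes : ∀ L →
    ∑[ γ ∈ words K L ] (𝟙 (all? (_≤? m) γ) * χ γ) ≡
    𝟙 (i <? f) * (jcount L (m ∸ i) (f ∸ i ∸ 1) + δ f (suc m) * ∑[ ℓ ∈ upTo L ] kcount ℓ (m ∸ i))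
  ∑-suffixes L = begin
    ∑[ γ ∈ words K L ] (𝟙 (all? (_≤? m) γ) * χ γ)
      ≡⟨ trans (∑-cong (words K L) χ-split) (∑-+ (words K L) _ _) ⟩
    ∑[ γ ∈ words K L ] (𝟙 (all? allowed? γ) * χ γ) + ∑[ γ ∈ words K L ] (𝟙 (m ∈? γ) * (𝟙 (all? (_≤? m) γ) * χ γ))
      ≡⟨ cong₂ _+_ (∑-free-suffixes L) (∑-repeat-suffixes L) ⟩
    𝟙 (i <? f) * J + 𝟙 (f ≟ suc m) * R
      ≡⟨ cong (𝟙 (i <? f) * J +_) (repeat⇒i<f (f ≟ suc m)) ⟩
    𝟙 (i <? f) * J + 𝟙 (i <? f) * (𝟙 (f ≟ suc m) * R)
      ≡⟨ sym (*-distribˡ-+ (𝟙 (i <? f)) J _) ⟩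
    𝟙 (i <? f) * (J + 𝟙 (f ≟ suc m) * R)
      ≡⟨ cong (λ d → 𝟙 (i <? f) * (J + d * R)) (sym (δ≡𝟙 f (suc m))) ⟩
    𝟙 (i <? f) * (J + δ f (suc m) * R)
      ≡⟨ cong (λ k → 𝟙 (i <? f) * (jcount L k (f ∸ i ∸ 1) + δ f (suc m) * ∑[ ℓ ∈ upTo L ] kcount ℓ k)) c≡m∸i ⟩
    𝟙 (i <? f) * (jcount L (m ∸ i) (f ∸ i ∸ 1) + δ f (suc m) * ∑[ ℓ ∈ upTo L ] kcount ℓ (m ∸ i))
      ∎
    where
    open ≡-Reasoning
    J R : ℕ
    J = jcount L c (f ∸ i ∸ 1)
    R = ∑[ ℓ ∈ upTo L ] kcount ℓ c
    repeat⇒i<f : (d : Dec (f ≡ suc m)) → 𝟙 d * R ≡ 𝟙 (i <? f) * (𝟙 d * R)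
    repeat⇒i<f (yes refl) rewrite 𝟙-yes (i <? suc m) (s≤s i≤m) = sym (*-identityˡ _)
    repeat⇒i<f (no _)     = sym (*-zeroʳ (𝟙 (i <? f)))

𝟙𝔏 : ℕ → ℕ → List ℕ → ℕ
𝟙𝔏 m f σ = 𝟙 (isInvFrom? 1 σ) * 𝟙 (avoids? σ ×-dec (maxL σ ≟ m) ×-dec (forb σ ≟ f))

𝟙𝔏-no : ∀ {m f} σ → ¬ (IsInv σ × Avoids σ × maxL σ ≡ m × forb σ ≡ f) → 𝟙𝔏 m f σ ≡ 0
𝟙𝔏-no σ ¬p = trans (sym (𝟙-× (isInvFrom? 1 σ) _)) (𝟙-no _ (λ (inv , rest) → ¬p (inv , rest)))

lcount≡∑ : ∀ n m f → lcount n m f ≡ ∑[ σ ∈ words n n ] 𝟙𝔏 m f σ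
lcount≡∑ n m f = trans (length-filter≡∑ _ (filter (isInvFrom? 1) (words n n))) (∑-filter (isInvFrom? 1) (words n n) _)

∑-𝟙𝔏-words : ∀ K a m f → a ≤ K → ∑[ α ∈ words K a ] 𝟙𝔏 m f α ≡ lcount a m f
∑-𝟙𝔏-words K a m f a≤K = trans (∑-words-shrink K a a (𝟙𝔏 m f) a≤K notInv) (sym (lcount≡∑ a m f))
  where
  notInv : ∀ w → length w ≡ a → ¬ All (_< a) w → 𝟙𝔏 m f w ≡ 0
  notInv w |w|≡a w≮a = 𝟙𝔏-no w (λ (inv , _) → w≮a (subst (λ k → All (_< k) w) |w|≡a (IsInvFrom⇒All< 0 w inv)))

maxL≡⇒∈ : ∀ {m} σ → 1 ≤ m → maxL σ ≡ m → m ∈ σ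
maxL≡⇒∈ σ 1≤m max≡m with maxL≡0⊎∈ σ
... | inj₁ max≡0 = ⊥-elim (<⇒≢ 1≤m (sym (trans (sym max≡m) max≡0)))
... | inj₂ max∈  = subst (_∈ σ) max≡m max∈

𝟙𝔏-extend : ∀ {α m f K} (avα : Avoids α) (α<m : All (_< m) α) (m<K : m < K) → IsInv α → m < suc (length α) →
  ∀ γ → 𝟙𝔏 m f (α ++ m ∷ γ) ≡ 𝟙 (all? (_≤? m) γ) * Suffixes.χ α m f K avα α<m m<K γ
𝟙𝔏-extend {α} {m} {f} avα α<m m<K invα m<1+|α| γ with all? (_≤? m) γ
... | yes γ≤m = trans
  (cong (_* 𝟙 (avoids? σ ×-dec (maxL σ ≟ m) ×-dec (forb σ ≟ f))) (𝟙-yes (isInvFrom? 1 σ) invσ))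
  (cong (_+ 0) (𝟙-cong (λ (av , _ , forb≡f) → av , forb≡f) (λ (av , forb≡f) → av , maxσ≡m , forb≡f) _ _))
  where
  σ : List ℕ
  σ = α ++ m ∷ γ
  invσ : IsInv σ
  invσ = IsInvFrom-++⁺ 1 α (m ∷ γ) invα
    (m<1+|α| , All<⇒IsInvFrom (2 + length α) γ (All.map (λ x≤m → s≤s (≤-trans x≤m (<⇒≤ m<1+|α|))) γ≤m))
  maxσ≡m : maxL σ ≡ m
  maxσ≡m = trans (maxL-++ α (m ∷ γ))
    (trans (cong (maxL α ⊔_) (m≥n⇒m⊔n≡m (maxL-lub γ γ≤m))) (m≤n⇒m⊔n≡n (maxL-lub α (All.map <⇒≤ α<m))))
... | no γ≰m = 𝟙𝔏-no (α ++ m ∷ γ) (λ (_ , _ , max≡m , _) → γ≰m (tabulate (λ x∈γ →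
  subst (_ ≤_) max≡m (∈⇒≤maxL {σ = α ++ m ∷ γ} (∈-++⁺ʳ α (there x∈γ))))))

module _ (n m f : ℕ) where

  suffixCount : ℕ → ℕ → ℕ
  suffixCount p i = jcount (n ∸ p) (m ∸ i) (f ∸ i ∸ 1) + δ f (suc m) * sumBelow (n ∸ p) (λ ℓ → kcount ℓ (m ∸ i))

  prefixWeight : ℕ → ℕ
  prefixWeight p = sumBelow f (λ i → sumBelow m (λ j → lcount (p ∸ 1) j i * suffixCount p i))

module Decomposition (n m f : ℕ) (1≤m : 1 ≤ m) (m<n : m < n) where

  -- The first m sits at position a + 1, which an inversion sequence allows iff m < a + 1.
  ValidPrefix : List ℕ → ℕ → Set
  ValidPrefix α a = IsInv α × Avoids α × maxL α < m × m < suc a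

  validPrefix? : ∀ α a → Dec (ValidPrefix α a)
  validPrefix? α a = isInvFrom? 1 α ×-dec avoids? α ×-dec (maxL α <? m) ×-dec (m <? suc a)

  𝟙𝔏-prefix : ∀ α a j i → j < m →
    𝟙 (m <? suc a) * 𝟙𝔏 j i α ≡ 𝟙 (validPrefix? α a) * (𝟙 (maxL α ≟ j) * 𝟙 (forb α ≟ i))
  𝟙𝔏-prefix α a j i j<m = begin
    𝟙 (m <? suc a) * (𝟙 (isInvFrom? 1 α) * 𝟙 rest)
      ≡⟨ cong (𝟙 (m <? suc a) *_) (sym (𝟙-× (isInvFrom? 1 α) rest)) ⟩
    𝟙 (m <? suc a) * 𝟙 (isInvFrom? 1 α ×-dec rest)
      ≡⟨ sym (𝟙-× (m <? suc a) _) ⟩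
    𝟙 (m <? suc a ×-dec isInvFrom? 1 α ×-dec rest)
      ≡⟨ 𝟙-cong to from _ (validPrefix? α a ×-dec ((maxL α ≟ j) ×-dec (forb α ≟ i))) ⟩
    𝟙 (validPrefix? α a ×-dec ((maxL α ≟ j) ×-dec (forb α ≟ i)))
      ≡⟨ trans (𝟙-× (validPrefix? α a) _) (cong (𝟙 (validPrefix? α a) *_) (𝟙-× (maxL α ≟ j) (forb α ≟ i))) ⟩
    𝟙 (validPrefix? α a) * (𝟙 (maxL α ≟ j) * 𝟙 (forb α ≟ i))
      ∎
    where
    open ≡-Reasoning
    rest : Dec (Avoids α × maxL α ≡ j × forb α ≡ i)
    rest = avoids? α ×-dec (maxL α ≟ j) ×-dec (forb α ≟ i)
    to : m < suc a × IsInv α × Avoids α × maxL α ≡ j × forb α ≡ i → ValidPrefix α a × maxL α ≡ j × forb α ≡ i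
    to (m<1+a , inv , av , max≡j , forb≡i) = (inv , av , subst (_< m) (sym max≡j) j<m , m<1+a) , max≡j , forb≡i
    from : ValidPrefix α a × maxL α ≡ j × forb α ≡ i → m < suc a × IsInv α × Avoids α × maxL α ≡ j × forb α ≡ i
    from ((inv , av , _ , m<1+a) , max≡j , forb≡i) = m<1+a , inv , av , max≡j , forb≡i

  ∑-𝟙𝔏-prefix : ∀ α a →
    ∑[ i ∈ upTo f ] ∑[ j ∈ upTo m ] (𝟙 (m <? suc a) * 𝟙𝔏 j i α * suffixCount n m f (suc a) i) ≡
    𝟙 (validPrefix? α a) * (𝟙 (forb α <? f) * suffixCount n m f (suc a) (forb α))
  ∑-𝟙𝔏-prefix α a = begin
    ∑[ i ∈ upTo f ] ∑[ j ∈ upTo m ] (𝟙 (m <? suc a) * 𝟙𝔏 j i α * T i)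
      ≡⟨ ∑-cong (upTo f) (λ i → ∑-upTo-cong m (summand i)) ⟩
    ∑[ i ∈ upTo f ] ∑[ j ∈ upTo m ] (v * (𝟙 (maxL α ≟ j) * (𝟙 (forb α ≟ i) * T i)))
      ≡⟨ ∑-cong (upTo f) (λ i → ∑-*ˡ (upTo m) v _) ⟩
    ∑[ i ∈ upTo f ] (v * ∑[ j ∈ upTo m ] (𝟙 (maxL α ≟ j) * (𝟙 (forb α ≟ i) * T i)))
      ≡⟨ ∑-cong (upTo f) (λ i → cong (v *_) (∑-upTo-point (maxL α) m _)) ⟩
    ∑[ i ∈ upTo f ] (v * (𝟙 (maxL α <? m) * (𝟙 (forb α ≟ i) * T i)))
      ≡⟨ ∑-cong (upTo f) (λ i → trans (sym (*-assoc v _ _)) (cong (_* (𝟙 (forb α ≟ i) * T i)) max<m)) ⟩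
    ∑[ i ∈ upTo f ] (v * (𝟙 (forb α ≟ i) * T i))
      ≡⟨ ∑-*ˡ (upTo f) v _ ⟩
    v * ∑[ i ∈ upTo f ] (𝟙 (forb α ≟ i) * T i)
      ≡⟨ cong (v *_) (∑-upTo-point (forb α) f T) ⟩
    v * (𝟙 (forb α <? f) * T (forb α))
      ∎
    where
    open ≡-Reasoning
    T : ℕ → ℕ
    T = suffixCount n m f (suc a)
    v : ℕ
    v = 𝟙 (validPrefix? α a)
    summand : ∀ i j → j < m → 𝟙 (m <? suc a) * 𝟙𝔏 j i α * T i ≡ v * (𝟙 (maxL α ≟ j) * (𝟙 (forb α ≟ i) * T i))
    summand i j j<m = begin
      𝟙 (m <? suc a) * 𝟙𝔏 j i α * T i                       ≡⟨ cong (_* T i) (𝟙𝔏-prefix α a j i j<m) ⟩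
      v * (𝟙 (maxL α ≟ j) * 𝟙 (forb α ≟ i)) * T i           ≡⟨ *-assoc v _ (T i) ⟩
      v * (𝟙 (maxL α ≟ j) * 𝟙 (forb α ≟ i) * T i)           ≡⟨ cong (v *_) (*-assoc (𝟙 (maxL α ≟ j)) _ (T i)) ⟩
      v * (𝟙 (maxL α ≟ j) * (𝟙 (forb α ≟ i) * T i))         ∎
    max<m : v * 𝟙 (maxL α <? m) ≡ v
    max<m = 𝟙-absorbˡ (proj₁ ∘ proj₂ ∘ proj₂) (validPrefix? α a) (maxL α <? m)

  ValidPrefix-of : ∀ α γ → m ∉ α → IsInv (α ++ m ∷ γ) → Avoids (α ++ m ∷ γ) → maxL (α ++ m ∷ γ) ≡ m →
    ValidPrefix α (length α)
  ValidPrefix-of α γ m∉α inv av max≡m =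
    let invα , (m<1+|α| , _) = IsInvFrom-++⁻ 1 α (m ∷ γ) inv in
    invα , Avoids-++ˡ α (m ∷ γ) av , ≤∧≢⇒< maxα≤m (λ maxα≡m → m∉α (maxL≡⇒∈ α 1≤m maxα≡m)) , m<1+|α|
    where
    maxα≤m : maxL α ≤ m
    maxα≤m = subst (maxL α ≤_) max≡m (subst (maxL α ≤_) (sym (maxL-++ α (m ∷ γ))) (m≤m⊔n (maxL α) _))

  ∑-𝟙𝔏-suffixes : ∀ α →
    𝟙 (m ∉? α) * ∑[ γ ∈ words n (n ∸ suc (length α)) ] 𝟙𝔏 m f (α ++ m ∷ γ) ≡
    𝟙 (validPrefix? α (length α)) * (𝟙 (forb α <? f) * suffixCount n m f (suc (length α)) (forb α))
  ∑-𝟙𝔏-suffixes α with validPrefix? α (length α)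
  ... | yes (invα , avα , maxα<m , m<1+|α|) = begin
    𝟙 (m ∉? α) * ∑[ γ ∈ words n L ] 𝟙𝔏 m f (α ++ m ∷ γ)
      ≡⟨ cong₂ _*_ (𝟙-yes (m ∉? α) (λ m∈α → <⇒≱ maxα<m (∈⇒≤maxL m∈α))) (∑-cong (words n L) (𝟙𝔏-extend avα α<m m<n invα m<1+|α|)) ⟩
    1 * ∑[ γ ∈ words n L ] (𝟙 (all? (_≤? m) γ) * Suffixes.χ α m f n avα α<m m<n γ)
      ≡⟨ cong (1 *_) (Suffixes.∑-suffixes α m f n avα α<m m<n L) ⟩
    1 * (𝟙 (forb α <? f) * suffixCount n m f (suc (length α)) (forb α))
      ∎
    where
    open ≡-Reasoning
    L : ℕ
    L = n ∸ suc (length α)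
    α<m : All (_< m) α
    α<m = tabulate (λ x∈α → ≤-<-trans (∈⇒≤maxL x∈α) maxα<m)
  ... | no ¬valid with m ∈? α
  ...   | yes _   = refl
  ...   | no m∉α = trans (+-identityʳ _) (∑-zero (words n (n ∸ suc (length α))) (λ γ → 𝟙𝔏 m f (α ++ m ∷ γ)) (λ γ _ →
                     𝟙𝔏-no (α ++ m ∷ γ) (λ (inv , av , max≡m , _) → ¬valid (ValidPrefix-of α γ m∉α inv av max≡m))))

  𝟙𝔏-first-m : ∀ a α → length α ≡ a →
    𝟙 (m ∉? α) * ∑[ γ ∈ words n (n ∸ suc a) ] 𝟙𝔏 m f (α ++ m ∷ γ) ≡
    ∑[ i ∈ upTo f ] ∑[ j ∈ upTo m ] (𝟙 (m <? suc a) * 𝟙𝔏 j i α * suffixCount n m f (suc a) i)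
  𝟙𝔏-first-m _ α refl = trans (∑-𝟙𝔏-suffixes α) (sym (∑-𝟙𝔏-prefix α (length α)))

  ∑-prefixes : ∀ a → a < n →
    ∑[ α ∈ words n a ] ∑[ i ∈ upTo f ] ∑[ j ∈ upTo m ] (𝟙 (m <? suc a) * 𝟙𝔏 j i α * suffixCount n m f (suc a) i) ≡
    𝟙 (m <? suc a) * prefixWeight n m f (suc a)
  ∑-prefixes a a<n = begin
    ∑[ α ∈ words n a ] ∑[ i ∈ upTo f ] ∑[ j ∈ upTo m ] (c * 𝟙𝔏 j i α * T i)
      ≡⟨ ∑-comm (words n a) (upTo f) _ ⟩
    ∑[ i ∈ upTo f ] ∑[ α ∈ words n a ] ∑[ j ∈ upTo m ] (c * 𝟙𝔏 j i α * T i)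
      ≡⟨ ∑-cong (upTo f) (λ i → ∑-comm (words n a) (upTo m) _) ⟩
    ∑[ i ∈ upTo f ] ∑[ j ∈ upTo m ] ∑[ α ∈ words n a ] (c * 𝟙𝔏 j i α * T i)
      ≡⟨ ∑-cong (upTo f) (λ i → ∑-cong (upTo m) (λ j → prefixes j i)) ⟩
    ∑[ i ∈ upTo f ] ∑[ j ∈ upTo m ] (c * (lcount a j i * T i))
      ≡⟨ ∑-cong (upTo f) (λ i → ∑-*ˡ (upTo m) c _) ⟩
    ∑[ i ∈ upTo f ] (c * ∑[ j ∈ upTo m ] (lcount a j i * T i))
      ≡⟨ ∑-*ˡ (upTo f) c _ ⟩
    c * prefixWeight n m f (suc a)
      ∎
    where
    open ≡-Reasoning
    c : ℕ
    c = 𝟙 (m <? suc a)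
    T : ℕ → ℕ
    T = suffixCount n m f (suc a)
    prefixes : ∀ j i → ∑[ α ∈ words n a ] (c * 𝟙𝔏 j i α * T i) ≡ c * (lcount a j i * T i)
    prefixes j i = begin
      ∑[ α ∈ words n a ] (c * 𝟙𝔏 j i α * T i)  ≡⟨ ∑-*ʳ (words n a) (T i) _ ⟩
      ∑[ α ∈ words n a ] (c * 𝟙𝔏 j i α) * T i  ≡⟨ cong (_* T i) (∑-*ˡ (words n a) c _) ⟩
      c * ∑[ α ∈ words n a ] 𝟙𝔏 j i α * T i    ≡⟨ cong (λ k → c * k * T i) (∑-𝟙𝔏-words n a j i (<⇒≤ a<n)) ⟩
      c * lcount a j i * T i                    ≡⟨ *-assoc c _ _ ⟩
      c * (lcount a j i * T i)                  ∎

  lcount-decomposition : lcount n m f ≡ sumFromTo (suc m) n (prefixWeight n m f)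
  lcount-decomposition = begin
    lcount n m f
      ≡⟨ lcount≡∑ n m f ⟩
    ∑[ σ ∈ words n n ] 𝟙𝔏 m f σ
      ≡⟨ ∑-cong (words n n) containsM ⟩
    ∑[ σ ∈ words n n ] (𝟙 (m ∈? σ) * 𝟙𝔏 m f σ)
      ≡⟨ ∑-words-∈ n (𝟙𝔏 m f) ⟩
    ∑[ a ∈ upTo n ] firstAt (n ∸ suc a) (𝟙𝔏 m f) a
      ≡⟨ ∑-upTo-cong n (λ a a<n → trans (∑-words-cong n a (λ α |α|≡a _ → 𝟙𝔏-first-m a α |α|≡a)) (∑-prefixes a a<n)) ⟩
    ∑[ a ∈ upTo n ] (𝟙 (m <? suc a) * prefixWeight n m f (suc a))
      ≡⟨ ∑-upTo-from m n (prefixWeight n m f) m<n ⟩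
    sumFromTo (suc m) n (prefixWeight n m f)
      ∎
    where
    open FirstOccurrence m n m<n
    open ≡-Reasoning
    containsM : ∀ σ → 𝟙𝔏 m f σ ≡ 𝟙 (m ∈? σ) * 𝟙𝔏 m f σ
    containsM σ with m ∈? σ
    ... | yes _  = sym (+-identityʳ _)
    ... | no m∉σ = 𝟙𝔏-no σ (λ (_ , _ , max≡m , _) → m∉σ (maxL≡⇒∈ σ 1≤m max≡m))

lcount-vanishing : ∀ n m f → 1 ≤ m → n ≤ m → lcount n m f ≡ 0
lcount-vanishing n m f 1≤m n≤m = begin
  lcount n m f                 ≡⟨ lcount≡∑ n m f ⟩
  ∑[ σ ∈ words n n ] 𝟙𝔏 m f σ  ≡⟨ ∑-words-cong n n (λ σ _ σ<n → 𝟙𝔏-no σ (λ (_ , _ , max≡m , _) → maxBelow σ σ<n max≡m)) ⟩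
  ∑[ σ ∈ words n n ] 0         ≡⟨ ∑-zero (words n n) (λ _ → 0) (λ _ _ → refl) ⟩
  0                            ∎
  where
  open ≡-Reasoning
  maxBelow : ∀ σ → All (_< n) σ → maxL σ ≢ m
  maxBelow σ σ<n max≡m = <⇒≱ (lookup σ<n (maxL≡⇒∈ σ 1≤m max≡m)) n≤m

theorem5 : (n m f : ℕ) → 1 ≤ n → 1 ≤ m →
  lcount n m f ≡
    sumFromTo (suc m) n (λ p →
      sumBelow f (λ i →
        sumBelow m (λ j →
          lcount (p ∸ 1) j i *
            (jcount (n ∸ p) (m ∸ i) (f ∸ i ∸ 1)
              + δ f (suc m) * sumBelow (n ∸ p) (λ ℓ → kcount ℓ (m ∸ i))))))
theorem5 n m f _ 1≤m with m <? n
... | yes m<n = lcount-decomposition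
  where open Decomposition n m f 1≤m m<n
... | no m≮n  = trans (lcount-vanishing n m f 1≤m n≤m) (sym (sumFromTo-empty (suc m) n (prefixWeight n m f) (s≤s n≤m)))
  where
  n≤m : n ≤ m
  n≤m = ≮⇒≥ m≮n
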